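{- Let $\Gamma=(K_n,\sigma)$ be a signed complete graph and let $\{X_1,\ldots,X_p,X_{p+1},\ldots,X_{p+q}\}$ be a partition of $V(\Gamma)$ into nonempty sets with $|X_i|=n_i$ such that: for all $i\neq j$, all edges between $X_i$ and $X_j$ have the same sign; for $i=1,\ldots,p$, all edges inside $X_i$ are positive (i.e. $\Gamma[X_i]=(K_{n_i},+)$); and for $i=p+1,\ldots,p+q$, all edges inside $X_i$ are negative (i.e. $\Gamma[X_i]=(K_{n_i},-)$). Let $B$ be the quotient matrix of $A(\Gamma)$ with respect to this partition, and let $m_1=\sum_{i=1}^p n_i$, $m_2=\sum_{i=p+1}^{p+q} n_i$. Then $$\varphi(\Gamma,\lambda)=(\lambda+1)^{m_1-p}(\lambda-1)^{m_2-q}\varphi(B,\lambda).$$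
   Context: A signed graph $\Gamma=(G,\sigma)$ has signature $\sigma:E(G)\to\{+,-\}$; its adjacency matrix has $(i,j)$ entry $\sigma(v_iv_j)$ if $v_iv_j\in E(G)$ and $0$ otherwise. $\varphi(M,\lambda)=\det(\lambda I-M)$ for a square matrix $M$, and $\varphi(\Gamma,\lambda)=\varphi(A(\Gamma),\lambda)$. For a symmetric matrix $A$ whose rows and columns are partitioned by $\{X_1,\ldots,X_m\}$, with $A_{i,j}$ the submatrix with rows in $X_i$ and columns in $X_j$, the quotient matrix is the $m\times m$ matrix $B=(b_{ij})$ where $b_{ij}$ is the average row sum of $A_{i,j}$. -}

module Defs where

open import Data.Bool using (Bool; true; false; if_then_else_)
open import Data.Nat using (ℕ; zero; suc)
open import Data.Fin using (Fin; zero; suc; punchIn; _≟_)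
open import Data.Integer using (+_)
open import Data.Rational using (ℚ; 0ℚ; 1ℚ; _+_; _*_; -_; _-_; _/_)
open import Relation.Nullary using (yes; no)
open import Relation.Nullary.Decidable using (⌊_⌋)

data Sign : Set where
  pos neg : Sign

signVal : Sign → ℚ
signVal pos = 1ℚ
signVal neg = - 1ℚ

Matrix : ℕ → Set
Matrix n = Fin n → Fin n → ℚ

sumFin : (n : ℕ) → (Fin n → ℚ) → ℚ
sumFin zero    f = 0ℚ
sumFin (suc n) f = f zero + sumFin n (λ i → f (suc i))

sumFinℕ : (n : ℕ) → (Fin n → ℕ) → ℕ
sumFinℕ zero    f = 0
sumFinℕ (suc n) f = f zero Data.Nat.+ sumFinℕ n (λ i → f (suc i))

countFin : (n : ℕ) → (Fin n → Bool) → ℕ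
countFin zero    b = 0
countFin (suc n) b = (if b zero then 1 else 0) Data.Nat.+ countFin n (λ i → b (suc i))

powℚ : ℚ → ℕ → ℚ
powℚ x zero    = 1ℚ
powℚ x (suc k) = x * powℚ x k

det : (n : ℕ) → Matrix n → ℚ
det zero    M = 1ℚ
det (suc n) M = sumFin (suc n) (λ j → cof j * (M zero j * det n (λ i k → M (suc i) (punchIn j k))))
  where
  sgn : ℕ → ℚ
  sgn zero          = 1ℚ
  sgn (suc zero)    = - 1ℚ
  sgn (suc (suc k)) = sgn k
  cof : Fin (suc n) → ℚ
  cof j = sgn (Data.Fin.toℕ j)

idM : (n : ℕ) → Matrix n
idM n i j with i ≟ j
... | yes _ = 1ℚ
... | no  _ = 0ℚ

charPoly : (n : ℕ) → Matrix n → ℚ → ℚ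
charPoly n M x = det n (λ i j → x * idM n i j - M i j)

adjK : (n : ℕ) → (Fin n → Fin n → Sign) → Matrix n
adjK n σ u v with u ≟ v
... | yes _ = 0ℚ
... | no  _ = signVal (σ u v)

partSize : (n m : ℕ) → (Fin n → Fin m) → Fin m → ℕ
partSize n m part c = countFin n (λ u → ⌊ part u ≟ c ⌋)

inPart : {n m : ℕ} → (Fin n → Fin m) → Fin m → Fin n → ℚ
inPart part c u = if ⌊ part u ≟ c ⌋ then 1ℚ else 0ℚ

-- average: s / k  (k = 0 never occurs for nonempty parts; then 0 by convention)
average : ℚ → ℕ → ℚ
average s zero    = 0ℚ
average s (suc k) = s * ((+ 1) / suc k)

-- quotient matrix: b_ij = average row sum of A_{X_i, X_j}
--   = (Σ_{u ∈ X_i} Σ_{v ∈ X_j} A u v) / |X_i|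
quotientMatrix : (n m : ℕ) → Matrix n → (Fin n → Fin m) → Matrix m
quotientMatrix n m A part i j =
  average (sumFin n (λ u → inPart part i u * sumFin n (λ v → inPart part j v * A u v)))
          (partSize n m part i)

{-# OPTIONS --termination-depth=2 #-}
-- Let a c d be the common sign of the edges between the classes X_c and X_d, and a c c the sign
-- inside X_c.  For vertex weights w put
--   C_w u v = w v · a (part u) (part v) − [u = v] · a (part v) (part v),
-- so that A(Γ) = C_1.  If u ≠ u′ lie in one class c, subtracting row u from row u′ of xI − C_w and
-- then adding column u′ to column u leaves x + a c c as the only nonzero entry of row u′, and the
-- complementary minor is xI − C_w′ on the remaining vertices, where w′ adds the weight of u′ to
-- that of u.  Merging until every class is a single vertex gives
--   φ(Γ, x) = ∏_c (x + a c c)^(n_c − 1) · φ(C, x),   C c d = n_d · a c d − [c = d] · a d d,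
-- and C is the quotient matrix B because every row of the block A_{X_c,X_d} has the same sum.
-- Finally a c c = 1 for the p positive classes and −1 for the q negative ones.
module Submission where

open import Defs
open import Data.Bool using (Bool; true; false; if_then_else_)
open import Data.Nat using (ℕ; zero; suc; _+_; _∸_; _<_; _≤_; z≤n; s≤s; z<s)
import Data.Nat.Properties as ℕ
open import Data.Fin using (Fin; zero; suc; toℕ; punchIn; punchOut; fromℕ<; splitAt; _↑ˡ_; _↑ʳ_; _≟_)
open import Data.Fin.Properties using (punchIn-injective; punchInᵢ≢i; punchIn-punchOut; suc-injective)
import Data.Fin.Properties as Fin
import Data.Fin.Permutation.Components as PC
open import Data.Empty using (⊥-elim)
open import Data.Product using (∃; ∃₂; _×_; _,_; proj₁; proj₂)
open import Data.Sum using (_⊎_; inj₁; inj₂; [_,_]′)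
open import Function using (_∘_; id; case_of_)
open import Function.Definitions using (Injective)
open import Relation.Binary.Definitions using (tri<; tri≈; tri>)
open import Relation.Nullary using (Dec; yes; no; contradiction)
open import Relation.Nullary.Decidable using (⌊_⌋; ¬?; _×-dec_; dec-true; dec-false)
open import Relation.Binary.PropositionalEquality using (_≡_; _≢_; refl; sym; trans; cong; cong₂; subst; module ≡-Reasoning)
import Data.Integer as ℤ
import Data.Integer.Properties as ℤ
import Data.Nat.Coprimality as Coprimality
open import Data.Rational using (ℚ; 0ℚ; 1ℚ; _*_; -_; mkℚ; _/_; 1/_) renaming (_+_ to _+ℚ_; _-_ to _-ℚ_)
import Data.Rational.Properties as ℚ
import Data.Rational.Unnormalised.Base as ℚᵘ
import Data.Rational.Unnormalised.Properties as ℚᵘ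
open import Data.Rational.Solver using (module +-*-Solver)
open +-*-Solver using (solve; _:+_; _:*_; :-_; _:-_; _:=_; con)
open import Algebra.Bundles using (CommutativeMonoid)
import Algebra.Properties.CommutativeSemigroup as CommSemigroupProperties

open ≡-Reasoning

module +-Comm = CommSemigroupProperties (CommutativeMonoid.commutativeSemigroup ℚ.+-0-commutativeMonoid)
module ℚ*-Comm = CommSemigroupProperties (CommutativeMonoid.commutativeSemigroup ℚ.*-1-commutativeMonoid)
module ℕ+-Comm = CommSemigroupProperties ℕ.+-commutativeSemigroup

-- Finite sums and products

sumFin-cong : ∀ n {f g : Fin n → ℚ} → (∀ i → f i ≡ g i) → sumFin n f ≡ sumFin n g
sumFin-cong zero    f≗g = refl
sumFin-cong (suc n) f≗g = cong₂ _+ℚ_ (f≗g zero) (sumFin-cong n (λ i → f≗g (suc i)))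

sumFin-+ : ∀ n (f g : Fin n → ℚ) → sumFin n (λ i → f i +ℚ g i) ≡ sumFin n f +ℚ sumFin n g
sumFin-+ zero    f g = refl
sumFin-+ (suc n) f g = begin
  (f zero +ℚ g zero) +ℚ sumFin n (λ i → f (suc i) +ℚ g (suc i))
    ≡⟨ cong ((f zero +ℚ g zero) +ℚ_) (sumFin-+ n (λ i → f (suc i)) (λ i → g (suc i))) ⟩
  (f zero +ℚ g zero) +ℚ (sumFin n (λ i → f (suc i)) +ℚ sumFin n (λ i → g (suc i)))
    ≡⟨ +-Comm.interchange (f zero) (g zero) _ _ ⟩
  (f zero +ℚ sumFin n (λ i → f (suc i))) +ℚ (g zero +ℚ sumFin n (λ i → g (suc i))) ∎

sumFin-*ˡ : ∀ n c (f : Fin n → ℚ) → sumFin n (λ i → c * f i) ≡ c * sumFin n f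
sumFin-*ˡ zero    c f = sym (ℚ.*-zeroʳ c)
sumFin-*ˡ (suc n) c f = trans (cong (c * f zero +ℚ_) (sumFin-*ˡ n c (λ i → f (suc i))))
                              (sym (ℚ.*-distribˡ-+ c (f zero) _))

sumFin-zero : ∀ n (f : Fin n → ℚ) → (∀ i → f i ≡ 0ℚ) → sumFin n f ≡ 0ℚ
sumFin-zero zero    f f≗0 = refl
sumFin-zero (suc n) f f≗0 = cong₂ _+ℚ_ (f≗0 zero) (sumFin-zero n _ (λ i → f≗0 (suc i)))

sumFin-swap : ∀ n m (f : Fin n → Fin m → ℚ) →
              sumFin n (λ i → sumFin m (f i)) ≡ sumFin m (λ j → sumFin n (λ i → f i j))
sumFin-swap zero    m f = sym (sumFin-zero m _ (λ _ → refl))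
sumFin-swap (suc n) m f = trans (cong (sumFin m (f zero) +ℚ_) (sumFin-swap n m (λ i → f (suc i))))
                                (sym (sumFin-+ m (f zero) (λ j → sumFin n (λ i → f (suc i) j))))

sumFin-punchIn : ∀ n (f : Fin (suc n) → ℚ) j → sumFin (suc n) f ≡ f j +ℚ sumFin n (λ k → f (punchIn j k))
sumFin-punchIn n       f zero    = refl
sumFin-punchIn (suc n) f (suc j) = begin
  f zero +ℚ sumFin (suc n) (λ i → f (suc i))
    ≡⟨ cong (f zero +ℚ_) (sumFin-punchIn n (λ i → f (suc i)) j) ⟩
  f zero +ℚ (f (suc j) +ℚ sumFin n (λ k → f (suc (punchIn j k))))
    ≡⟨ +-Comm.x∙yz≈y∙xz (f zero) (f (suc j)) _ ⟩
  f (suc j) +ℚ (f zero +ℚ sumFin n (λ k → f (suc (punchIn j k)))) ∎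

sumFin-single : ∀ n (f : Fin n → ℚ) j → (∀ i → i ≢ j → f i ≡ 0ℚ) → sumFin n f ≡ f j
sumFin-single (suc n) f j f≗0 = begin
  sumFin (suc n) f                          ≡⟨ sumFin-punchIn n f j ⟩
  f j +ℚ sumFin n (λ k → f (punchIn j k))   ≡⟨ cong (f j +ℚ_) (sumFin-zero n _ (λ k → f≗0 _ (punchInᵢ≢i j k))) ⟩
  f j +ℚ 0ℚ                                 ≡⟨ ℚ.+-identityʳ (f j) ⟩
  f j                                       ∎

sumFin-pair : ∀ n (f : Fin (suc (suc n)) → ℚ) a b → a ≢ b → (∀ j → j ≢ a → j ≢ b → f j ≡ 0ℚ) →
              sumFin (suc (suc n)) f ≡ f a +ℚ f b
sumFin-pair n f a b a≢b f≗0 = begin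
  sumFin (suc (suc n)) f                             ≡⟨ sumFin-punchIn (suc n) f a ⟩
  f a +ℚ sumFin (suc n) (λ k → f (punchIn a k))      ≡⟨ cong (f a +ℚ_) (sumFin-single (suc n) _ b′ others) ⟩
  f a +ℚ f (punchIn a b′)                            ≡⟨ cong (λ c → f a +ℚ f c) (punchIn-punchOut a≢b) ⟩
  f a +ℚ f b                                         ∎
  where
  b′ : Fin (suc n)
  b′ = punchOut a≢b
  others : ∀ k → k ≢ b′ → f (punchIn a k) ≡ 0ℚ
  others k k≢b′ = f≗0 _ (punchInᵢ≢i a k)
    (λ eq → k≢b′ (punchIn-injective a k b′ (trans eq (sym (punchIn-punchOut a≢b)))))

sumFin-*ˡ-*ˡ : ∀ n c a (f : Fin n → ℚ) → sumFin n (λ i → c * (a * f i)) ≡ c * (a * sumFin n f)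
sumFin-*ˡ-*ˡ n c a f = trans (sumFin-*ˡ n c (λ i → a * f i)) (cong (c *_) (sumFin-*ˡ n a f))

prodFin : (m : ℕ) → (Fin m → ℚ) → ℚ
prodFin zero    f = 1ℚ
prodFin (suc m) f = f zero * prodFin m (f ∘ suc)

prodFin-cong : ∀ m {f g : Fin m → ℚ} → (∀ i → f i ≡ g i) → prodFin m f ≡ prodFin m g
prodFin-cong zero    f≗g = refl
prodFin-cong (suc m) f≗g = cong₂ _*_ (f≗g zero) (prodFin-cong m (f≗g ∘ suc))

prodFin-ones : ∀ m (f : Fin m → ℚ) → (∀ i → f i ≡ 1ℚ) → prodFin m f ≡ 1ℚ
prodFin-ones zero    f f≗1 = refl
prodFin-ones (suc m) f f≗1 = cong₂ _*_ (f≗1 zero) (prodFin-ones m (f ∘ suc) (f≗1 ∘ suc))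

prodFin-update : ∀ m (f g : Fin m → ℚ) y c → f c ≡ y * g c → (∀ d → d ≢ c → f d ≡ g d) →
                 prodFin m f ≡ y * prodFin m g
prodFin-update (suc m) f g y zero fc f≗g = begin
  f zero * prodFin m (f ∘ suc)         ≡⟨ cong₂ _*_ fc (prodFin-cong m (λ i → f≗g (suc i) (λ ()))) ⟩
  (y * g zero) * prodFin m (g ∘ suc)   ≡⟨ ℚ.*-assoc y (g zero) _ ⟩
  y * (g zero * prodFin m (g ∘ suc))   ∎
prodFin-update (suc m) f g y (suc c) fc f≗g = begin
  f zero * prodFin m (f ∘ suc)         ≡⟨ cong₂ _*_ (f≗g zero (λ ())) rest ⟩
  g zero * (y * prodFin m (g ∘ suc))   ≡⟨ ℚ*-Comm.x∙yz≈y∙xz (g zero) y _ ⟩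
  y * (g zero * prodFin m (g ∘ suc))   ∎
  where
  rest : prodFin m (f ∘ suc) ≡ y * prodFin m (g ∘ suc)
  rest = prodFin-update m (f ∘ suc) (g ∘ suc) y c fc (λ d d≢c → f≗g (suc d) (d≢c ∘ suc-injective))

prodFin-++ : ∀ p q (f : Fin (p + q) → ℚ) →
             prodFin (p + q) f ≡ prodFin p (λ i → f (i ↑ˡ q)) * prodFin q (λ i → f (p ↑ʳ i))
prodFin-++ zero    q f = sym (ℚ.*-identityˡ (prodFin q f))
prodFin-++ (suc p) q f = trans (cong (f zero *_) (prodFin-++ p q (f ∘ suc))) (sym (ℚ.*-assoc (f zero) _ _))

powℚ-+ : ∀ y k l → powℚ y (k + l) ≡ powℚ y k * powℚ y l
powℚ-+ y zero    l = sym (ℚ.*-identityˡ (powℚ y l))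
powℚ-+ y (suc k) l = trans (cong (y *_) (powℚ-+ y k l)) (sym (ℚ.*-assoc y _ _))

powℚ-pred : ∀ y {k} → 0 < k → powℚ y k ≡ y * powℚ y (k ∸ 1)
powℚ-pred y {suc k} _ = refl

sumFinℕ-positive : ∀ p (g : Fin p → ℕ) → (∀ i → 0 < g i) → p ≤ sumFinℕ p g
sumFinℕ-positive zero    g g>0 = z≤n
sumFinℕ-positive (suc p) g g>0 = ℕ.+-mono-≤ (g>0 zero) (sumFinℕ-positive p (g ∘ suc) (g>0 ∘ suc))

prodFin-powℚ : ∀ p y (g : Fin p → ℕ) → (∀ i → 0 < g i) →
               prodFin p (λ i → powℚ y (g i ∸ 1)) ≡ powℚ y (sumFinℕ p g ∸ p)
prodFin-powℚ zero    y g g>0 = refl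
prodFin-powℚ (suc p) y g g>0 with g zero | g>0 zero
... | suc k | _ = begin
  powℚ y k * prodFin p (λ i → powℚ y (g (suc i) ∸ 1))
    ≡⟨ cong (powℚ y k *_) (prodFin-powℚ p y (g ∘ suc) (g>0 ∘ suc)) ⟩
  powℚ y k * powℚ y (sumFinℕ p (g ∘ suc) ∸ p)
    ≡⟨ powℚ-+ y k _ ⟨
  powℚ y (k + (sumFinℕ p (g ∘ suc) ∸ p))
    ≡⟨ cong (powℚ y) (ℕ.+-∸-assoc k (sumFinℕ-positive p (g ∘ suc) (g>0 ∘ suc))) ⟨
  powℚ y (k + sumFinℕ p (g ∘ suc) ∸ p) ∎

countFin-punchIn : ∀ n (b : Fin (suc n) → Bool) j →
                   countFin (suc n) b ≡ (if b j then 1 else 0) + countFin n (b ∘ punchIn j)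
countFin-punchIn n       b zero    = refl
countFin-punchIn (suc n) b (suc j) = begin
  β zero + countFin (suc n) (b ∘ suc)                       ≡⟨ cong (β zero +_) (countFin-punchIn n (b ∘ suc) j) ⟩
  β zero + (β (suc j) + countFin n (b ∘ suc ∘ punchIn j))   ≡⟨ ℕ+-Comm.x∙yz≈y∙xz (β zero) (β (suc j)) _ ⟩
  β (suc j) + (β zero + countFin n (b ∘ suc ∘ punchIn j))   ∎
  where
  β : Fin (suc (suc n)) → ℕ
  β i = if b i then 1 else 0

countFin-none : ∀ n (b : Fin n → Bool) → (∀ i → b i ≡ false) → countFin n b ≡ 0
countFin-none zero    b none = refl
countFin-none (suc n) b none rewrite none zero = countFin-none n (b ∘ suc) (none ∘ suc)

-- Determinants

sign : ℕ → ℚ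
sign zero          = 1ℚ
sign (suc zero)    = - 1ℚ
sign (suc (suc k)) = sign k

sign-suc : ∀ k → sign (suc k) ≡ - sign k
sign-suc zero          = refl
sign-suc (suc zero)    = refl
sign-suc (suc (suc k)) = sign-suc k

minor : ∀ {n} → Matrix (suc n) → Fin (suc n) → Fin (suc n) → Matrix n
minor M i j r c = M (punchIn i r) (punchIn j c)

laplaceTerm : ∀ {n} → Matrix (suc n) → Fin (suc n) → ℚ
laplaceTerm {n} M j = sign (toℕ j) * (M zero j * det n (minor M zero j))

sign-unique : (s : ℕ → ℚ) → s 0 ≡ 1ℚ → s 1 ≡ - 1ℚ → (∀ k → s (suc (suc k)) ≡ s k) → ∀ k → s k ≡ sign k
sign-unique s s0 s1 s2 zero          = s0
sign-unique s s0 s1 s2 (suc zero)    = s1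
sign-unique s s0 s1 s2 (suc (suc k)) = trans (s2 k) (sign-unique s s0 s1 s2 k)

-- The cofactor sign used by `det` is a local function of its where-block and cannot be named.
-- It is captured by the meta-variable `localSign`, which unification solves only once the
-- index `suc (toℕ j)` (and `_*_`) have been abstracted to variables.
mutual
  private
    localSign : (n : ℕ) → Matrix (suc n) → ℕ → ℚ
    localSign = _

  det-expand : ∀ n M → det (suc n) M ≡ sumFin (suc n) (laplaceTerm M)
  det-expand n M = cong (1ℚ * (M zero zero * det n (minor M zero zero)) +ℚ_)
                       (sumFin-cong n (localSign≡sign n M))

  private
    localSign≡sign : ∀ n (M : Matrix (suc n)) (j : Fin n) → _ ≡ _
    localSign≡sign n M j with Data.Nat.suc (toℕ j) | _*_
    ... | k | _·_ = cong (_· _) (sign-unique (localSign n M) refl refl (λ _ → refl) k)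

det-cong : ∀ n {M N : Matrix n} → (∀ i j → M i j ≡ N i j) → det n M ≡ det n N
det-cong zero    M≗N = refl
det-cong (suc n) {M} {N} M≗N = begin
  det (suc n) M                   ≡⟨ det-expand n M ⟩
  sumFin (suc n) (laplaceTerm M)  ≡⟨ sumFin-cong (suc n) term ⟩
  sumFin (suc n) (laplaceTerm N)  ≡⟨ det-expand n N ⟨
  det (suc n) N                   ∎
  where
  term : ∀ j → laplaceTerm M j ≡ laplaceTerm N j
  term j = cong₂ (λ m d → sign (toℕ j) * (m * d)) (M≗N zero j) (det-cong n (λ r c → M≗N _ _))

punchIn≢ : ∀ {n} {j c : Fin (suc n)} (j≢c : j ≢ c) {k} → k ≢ punchOut j≢c → punchIn j k ≢ c
punchIn≢ {j = j} j≢c {k} k≢ eq = k≢ (punchIn-injective j k _ (trans eq (sym (punchIn-punchOut j≢c))))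

det-linear : ∀ n (M N P : Matrix n) c α β →
             (∀ i k → k ≢ c → M i k ≡ N i k) → (∀ i k → k ≢ c → M i k ≡ P i k) →
             (∀ i → M i c ≡ α * N i c +ℚ β * P i c) →
             det n M ≡ α * det n N +ℚ β * det n P
det-linear (suc n) M N P c α β M≈N M≈P Mc = begin
  det (suc n) M
    ≡⟨ det-expand n M ⟩
  sumFin (suc n) (laplaceTerm M)
    ≡⟨ sumFin-cong (suc n) term ⟩
  sumFin (suc n) (λ j → α * laplaceTerm N j +ℚ β * laplaceTerm P j)
    ≡⟨ sumFin-+ (suc n) (λ j → α * laplaceTerm N j) (λ j → β * laplaceTerm P j) ⟩
  sumFin (suc n) (λ j → α * laplaceTerm N j) +ℚ sumFin (suc n) (λ j → β * laplaceTerm P j)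
    ≡⟨ cong₂ _+ℚ_ (sumFin-*ˡ (suc n) α (laplaceTerm N)) (sumFin-*ˡ (suc n) β (laplaceTerm P)) ⟩
  α * sumFin (suc n) (laplaceTerm N) +ℚ β * sumFin (suc n) (laplaceTerm P)
    ≡⟨ cong₂ (λ d e → α * d +ℚ β * e) (det-expand n N) (det-expand n P) ⟨
  α * det (suc n) N +ℚ β * det (suc n) P ∎
  where
  s : Fin (suc n) → ℚ
  s j = sign (toℕ j)
  term : ∀ j → laplaceTerm M j ≡ α * laplaceTerm N j +ℚ β * laplaceTerm P j
  term j with j ≟ c
  ... | yes refl = begin
    s j * (M zero j * det n (minor M zero j))
      ≡⟨ cong (λ m → s j * (m * det n (minor M zero j))) (Mc zero) ⟩
    s j * ((α * N zero j +ℚ β * P zero j) * det n (minor M zero j))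
      ≡⟨ solve 6 (λ s a b x y d → s :* ((a :* x :+ b :* y) :* d) := a :* (s :* (x :* d)) :+ b :* (s :* (y :* d)))
               refl (s j) α β (N zero j) (P zero j) (det n (minor M zero j)) ⟩
    α * (s j * (N zero j * det n (minor M zero j))) +ℚ β * (s j * (P zero j * det n (minor M zero j)))
      ≡⟨ cong₂ (λ d e → α * (s j * (N zero j * d)) +ℚ β * (s j * (P zero j * e)))
               (det-cong n (λ r k → M≈N _ _ (punchInᵢ≢i j k))) (det-cong n (λ r k → M≈P _ _ (punchInᵢ≢i j k))) ⟩
    α * laplaceTerm N j +ℚ β * laplaceTerm P j ∎
  ... | no j≢c = begin
    s j * (M zero j * det n (minor M zero j))
      ≡⟨ cong (λ d → s j * (M zero j * d)) minorLinear ⟩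
    s j * (M zero j * (α * det n (minor N zero j) +ℚ β * det n (minor P zero j)))
      ≡⟨ solve 6 (λ s m a b d e → s :* (m :* (a :* d :+ b :* e)) := a :* (s :* (m :* d)) :+ b :* (s :* (m :* e)))
               refl (s j) (M zero j) α β (det n (minor N zero j)) (det n (minor P zero j)) ⟩
    α * (s j * (M zero j * det n (minor N zero j))) +ℚ β * (s j * (M zero j * det n (minor P zero j)))
      ≡⟨ cong₂ (λ m m′ → α * (s j * (m * det n (minor N zero j))) +ℚ β * (s j * (m′ * det n (minor P zero j))))
               (M≈N zero j j≢c) (M≈P zero j j≢c) ⟩
    α * laplaceTerm N j +ℚ β * laplaceTerm P j ∎
    where
    minorLinear : det n (minor M zero j) ≡ α * det n (minor N zero j) +ℚ β * det n (minor P zero j)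
    minorLinear = det-linear n (minor M zero j) (minor N zero j) (minor P zero j) (punchOut j≢c) α β
      (λ r k k≢ → M≈N _ _ (punchIn≢ j≢c k≢)) (λ r k k≢ → M≈P _ _ (punchIn≢ j≢c k≢))
      (λ r → subst (λ c′ → M (suc r) c′ ≡ α * N (suc r) c′ +ℚ β * P (suc r) c′)
                   (sym (punchIn-punchOut j≢c)) (Mc (suc r)))

-- Expanding along row 0 and then every minor along its column 0, and vice versa, gives the same
-- double sum over the entries M 0 (k+1) and M (r+1) 0.
det-expand-col : ∀ n (M : Matrix (suc n)) →
                 det (suc n) M ≡ sumFin (suc n) (λ i → sign (toℕ i) * (M i zero * det n (minor M i zero)))
det-expand-col zero    M = det-expand zero M
det-expand-col (suc n) M = trans (det-expand (suc n) M) (cong (laplaceTerm M zero +ℚ_) (begin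
  sumFin (suc n) (λ k → s (suc k) * (M zero (suc k) * det (suc n) (minor M zero (suc k))))
    ≡⟨ sumFin-cong (suc n) (λ k → cong (λ d → s (suc k) * (M zero (suc k) * d))
                                       (det-expand-col n (minor M zero (suc k)))) ⟩
  sumFin (suc n) (λ k → s (suc k) * (M zero (suc k) * sumFin (suc n) (λ r → minorColTerm r k)))
    ≡⟨ sumFin-cong (suc n) (λ k → sumFin-*ˡ-*ˡ (suc n) (s (suc k)) (M zero (suc k)) (λ r → minorColTerm r k)) ⟨
  sumFin (suc n) (λ k → sumFin (suc n) (λ r → rowFirst r k))
    ≡⟨ sumFin-swap (suc n) (suc n) (λ k r → rowFirst r k) ⟩
  sumFin (suc n) (λ r → sumFin (suc n) (λ k → rowFirst r k))
    ≡⟨ sumFin-cong (suc n) (λ r → sumFin-cong (suc n) (reorder r)) ⟩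
  sumFin (suc n) (λ r → sumFin (suc n) (λ k → colFirst r k))
    ≡⟨ sumFin-cong (suc n) (λ r → sumFin-*ˡ-*ˡ (suc n) (s (suc r)) (M (suc r) zero) (λ k → minorRowTerm r k)) ⟩
  sumFin (suc n) (λ r → s (suc r) * (M (suc r) zero * sumFin (suc n) (λ k → minorRowTerm r k)))
    ≡⟨ sumFin-cong (suc n) (λ r → cong (λ d → s (suc r) * (M (suc r) zero * d))
                                       (det-expand n (minor M (suc r) zero))) ⟨
  sumFin (suc n) (λ r → s (suc r) * (M (suc r) zero * det (suc n) (minor M (suc r) zero))) ∎))
  where
  s : ∀ {m} → Fin m → ℚ
  s i = sign (toℕ i)
  X : Fin (suc n) → Fin (suc n) → ℚ
  X r k = det n (λ a b → M (suc (punchIn r a)) (suc (punchIn k b)))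
  minorColTerm minorRowTerm rowFirst colFirst : Fin (suc n) → Fin (suc n) → ℚ
  minorColTerm r k = s r * (M (suc r) zero * X r k)
  minorRowTerm r k = s k * (M zero (suc k) * X r k)
  rowFirst r k = s (suc k) * (M zero (suc k) * minorColTerm r k)
  colFirst r k = s (suc r) * (M (suc r) zero * minorRowTerm r k)
  reorder : ∀ r k → rowFirst r k ≡ colFirst r k
  reorder r k = begin
    s (suc k) * (M zero (suc k) * (s r * (M (suc r) zero * X r k)))
      ≡⟨ cong (λ t → t * (M zero (suc k) * (s r * (M (suc r) zero * X r k)))) (sign-suc (toℕ k)) ⟩
    - s k * (M zero (suc k) * (s r * (M (suc r) zero * X r k)))
      ≡⟨ solve 5 (λ sk sr a b x → (:- sk) :* (a :* (sr :* (b :* x))) := (:- sr) :* (b :* (sk :* (a :* x))))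
               refl (s k) (s r) (M zero (suc k)) (M (suc r) zero) (X r k) ⟩
    - s r * (M (suc r) zero * (s k * (M zero (suc k) * X r k)))
      ≡⟨ cong (λ t → t * (M (suc r) zero * (s k * (M zero (suc k) * X r k)))) (sign-suc (toℕ r)) ⟨
    s (suc r) * (M (suc r) zero * (s k * (M zero (suc k) * X r k))) ∎

_ᵀ : ∀ {n} → Matrix n → Matrix n
(M ᵀ) i j = M j i

det-ᵀ : ∀ n (M : Matrix n) → det n (M ᵀ) ≡ det n M
det-ᵀ zero    M = refl
det-ᵀ (suc n) M = begin
  det (suc n) (M ᵀ)
    ≡⟨ det-expand n (M ᵀ) ⟩
  sumFin (suc n) (laplaceTerm (M ᵀ))
    ≡⟨ sumFin-cong (suc n) (λ j → cong (λ d → sign (toℕ j) * (M j zero * d)) (det-ᵀ n (minor M j zero))) ⟩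
  sumFin (suc n) (λ i → sign (toℕ i) * (M i zero * det n (minor M i zero)))
    ≡⟨ det-expand-col n M ⟨
  det (suc n) M ∎

punchIn-adjacent : ∀ {n} (a b : Fin (suc n)) k → toℕ b ≡ suc (toℕ a) →
                   punchIn a k ≡ punchIn b k ⊎ (punchIn a k ≡ b × punchIn b k ≡ a)
punchIn-adjacent zero    (suc zero) zero    _     = inj₂ (refl , refl)
punchIn-adjacent zero    (suc zero) (suc k) _     = inj₁ refl
punchIn-adjacent (suc a) (suc b)    zero    _     = inj₁ refl
punchIn-adjacent (suc a) (suc b)    (suc k) b=a+1 with punchIn-adjacent a b k (ℕ.suc-injective b=a+1)
... | inj₁ eq         = inj₁ (cong suc eq)
... | inj₂ (eq , eq′) = inj₂ (cong suc eq , cong suc eq′)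

punchOut-adjacent : ∀ {n} (j a b : Fin (suc (suc n))) (j≢a : j ≢ a) (j≢b : j ≢ b) →
                    toℕ b ≡ suc (toℕ a) → toℕ (punchOut j≢b) ≡ suc (toℕ (punchOut j≢a))
punchOut-adjacent         zero          zero       _          j≢a _   _     = ⊥-elim (j≢a refl)
punchOut-adjacent         zero          (suc a)    (suc b)    _   _   b=a+1 = ℕ.suc-injective b=a+1
punchOut-adjacent {zero}  (suc zero)    zero       (suc zero) _   j≢b _     = ⊥-elim (j≢b refl)
punchOut-adjacent {suc n} (suc zero)    zero       (suc zero) _   j≢b _     = ⊥-elim (j≢b refl)
punchOut-adjacent {suc n} (suc (suc j)) zero       (suc zero) _   _   _     = refl
punchOut-adjacent {zero}  (suc zero)    (suc zero) (suc _)    j≢a _   _     = ⊥-elim (j≢a refl)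
punchOut-adjacent {suc n} (suc j)       (suc a)    (suc b)    j≢a j≢b b=a+1 =
  cong suc (punchOut-adjacent j a b (j≢a ∘ cong suc) (j≢b ∘ cong suc) (ℕ.suc-injective b=a+1))

-- Expanding along row 0: the two terms at the equal columns cancel (equal minors, opposite
-- signs) and every other minor again has two equal adjacent columns.
det-adjacentCols : ∀ n (M : Matrix n) a b → toℕ b ≡ suc (toℕ a) → (∀ i → M i a ≡ M i b) → det n M ≡ 0ℚ
det-adjacentCols (suc zero)    M zero zero ()
det-adjacentCols (suc (suc n)) M a b b=a+1 Ma≡Mb = begin
  det (suc (suc n)) M
    ≡⟨ det-expand (suc n) M ⟩
  sumFin (suc (suc n)) (laplaceTerm M)
    ≡⟨ sumFin-pair n (laplaceTerm M) a b a≢b others ⟩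
  laplaceTerm M a +ℚ laplaceTerm M b
    ≡⟨ cong₂ (λ s m → sa * (M zero a * D a) +ℚ s * (m * D b))
             (trans (cong sign b=a+1) (sign-suc (toℕ a))) (sym (Ma≡Mb zero)) ⟩
  sa * (M zero a * D a) +ℚ - sa * (M zero a * D b)
    ≡⟨ cong (λ d → sa * (M zero a * d) +ℚ - sa * (M zero a * D b)) equalMinors ⟩
  sa * (M zero a * D b) +ℚ - sa * (M zero a * D b)
    ≡⟨ solve 3 (λ s m d → s :* (m :* d) :+ (:- s) :* (m :* d) := con 0ℚ) refl sa (M zero a) (D b) ⟩
  0ℚ ∎
  where
  sa : ℚ
  sa = sign (toℕ a)
  D : Fin (suc (suc n)) → ℚ
  D j = det (suc n) (minor M zero j)
  a≢b : a ≢ b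
  a≢b refl = ℕ.<⇒≢ (ℕ.n<1+n (toℕ a)) b=a+1
  equalMinors : D a ≡ D b
  equalMinors = det-cong (suc n) λ r k → case punchIn-adjacent a b k b=a+1 of λ
    { (inj₁ eq)         → cong (M (suc r)) eq
    ; (inj₂ (eq , eq′)) → trans (cong (M (suc r)) eq) (trans (sym (Ma≡Mb (suc r))) (cong (M (suc r)) (sym eq′))) }
  others : ∀ j → j ≢ a → j ≢ b → laplaceTerm M j ≡ 0ℚ
  others j j≢a j≢b = begin
    sign (toℕ j) * (M zero j * D j) ≡⟨ cong (λ d → sign (toℕ j) * (M zero j * d)) minorVanishes ⟩
    sign (toℕ j) * (M zero j * 0ℚ) ≡⟨ solve 2 (λ s m → s :* (m :* con 0ℚ) := con 0ℚ) refl (sign (toℕ j)) (M zero j) ⟩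
    0ℚ ∎
    where
    minorVanishes : D j ≡ 0ℚ
    minorVanishes = det-adjacentCols (suc n) (minor M zero j) (punchOut j≢a) (punchOut j≢b)
      (punchOut-adjacent j a b j≢a j≢b b=a+1)
      (λ r → trans (cong (M (suc r)) (punchIn-punchOut j≢a))
                   (trans (Ma≡Mb (suc r)) (cong (M (suc r)) (sym (punchIn-punchOut j≢b)))))

module _ {n} (i j : Fin n) where
  open PC using (transpose)

  transpose-matchˡ : transpose i j i ≡ j
  transpose-matchˡ rewrite dec-true (i ≟ i) refl = refl

  transpose-matchʳ : transpose i j j ≡ i
  transpose-matchʳ with j ≟ i
  ... | yes j≡i = j≡i
  ... | no  _   rewrite dec-true (j ≟ j) refl = refl

  transpose-mismatch : ∀ {k} → k ≢ i → k ≢ j → transpose i j k ≡ k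
  transpose-mismatch {k} k≢i k≢j rewrite dec-false (k ≟ i) k≢i | dec-false (k ≟ j) k≢j = refl

  transpose-involutive : ∀ k → transpose i j (transpose i j k) ≡ k
  transpose-involutive k = by-cases (k ≟ i) (k ≟ j)
    where
    by-cases : Dec (k ≡ i) → Dec (k ≡ j) → transpose i j (transpose i j k) ≡ k
    by-cases (yes refl) _          = trans (cong (transpose i j) transpose-matchˡ) transpose-matchʳ
    by-cases (no _)     (yes refl) = trans (cong (transpose i j) transpose-matchʳ) transpose-matchˡ
    by-cases (no k≢i)   (no k≢j)   = trans (cong (transpose i j) (transpose-mismatch k≢i k≢j))
                                           (transpose-mismatch k≢i k≢j)

transpose-same : ∀ {n} (i k : Fin n) → PC.transpose i i k ≡ k
transpose-same i k = by-cases (k ≟ i)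
  where
  by-cases : Dec (k ≡ i) → PC.transpose i i k ≡ k
  by-cases (yes refl) = transpose-matchˡ k k
  by-cases (no k≢i)   = transpose-mismatch i i k≢i k≢i

replaceCols : ∀ {n} → Matrix n → Fin n → Fin n → (Fin n → ℚ) → (Fin n → ℚ) → Matrix n
replaceCols M a b y z i k with k ≟ a | k ≟ b
... | yes _ | _     = y i
... | no _  | yes _ = z i
... | no _  | no _  = M i k

module _ {n} (M : Matrix n) (a b : Fin n) where

  replaceCols-a : ∀ y z i → replaceCols M a b y z i a ≡ y i
  replaceCols-a y z i with a ≟ a
  ... | yes _   = refl
  ... | no  a≢a = contradiction refl a≢a

  replaceCols-b : a ≢ b → ∀ y z i → replaceCols M a b y z i b ≡ z i
  replaceCols-b a≢b y z i with b ≟ a | b ≟ b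
  ... | yes b≡a | _       = contradiction (sym b≡a) a≢b
  ... | no _    | yes _   = refl
  ... | no _    | no b≢b  = contradiction refl b≢b

  replaceCols-other : ∀ y z i {k} → k ≢ a → k ≢ b → replaceCols M a b y z i k ≡ M i k
  replaceCols-other y z i {k} k≢a k≢b with k ≟ a | k ≟ b
  ... | yes k≡a | _       = contradiction k≡a k≢a
  ... | no _    | yes k≡b = contradiction k≡b k≢b
  ... | no _    | no _    = refl

  replaceCols-congˡ : ∀ y y′ z i {k} → k ≢ a → replaceCols M a b y z i k ≡ replaceCols M a b y′ z i k
  replaceCols-congˡ y y′ z i {k} k≢a with k ≟ a | k ≟ b
  ... | yes k≡a | _     = contradiction k≡a k≢a
  ... | no _    | yes _ = refl
  ... | no _    | no _  = refl

  replaceCols-congʳ : ∀ y z z′ i {k} → k ≢ b → replaceCols M a b y z i k ≡ replaceCols M a b y z′ i k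
  replaceCols-congʳ y z z′ i {k} k≢b with k ≟ a | k ≟ b
  ... | yes _ | _       = refl
  ... | no _  | yes k≡b = contradiction k≡b k≢b
  ... | no _  | no _    = refl

det-additive : ∀ n (M N P : Matrix n) c →
               (∀ i k → k ≢ c → M i k ≡ N i k) → (∀ i k → k ≢ c → M i k ≡ P i k) →
               (∀ i → M i c ≡ N i c +ℚ P i c) → det n M ≡ det n N +ℚ det n P
det-additive n M N P c M≈N M≈P Mc = begin
  det n M                          ≡⟨ det-linear n M N P c 1ℚ 1ℚ M≈N M≈P Mc′ ⟩
  1ℚ * det n N +ℚ 1ℚ * det n P     ≡⟨ cong₂ _+ℚ_ (ℚ.*-identityˡ (det n N)) (ℚ.*-identityˡ (det n P)) ⟩
  det n N +ℚ det n P               ∎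
  where
  Mc′ : ∀ i → M i c ≡ 1ℚ * N i c +ℚ 1ℚ * P i c
  Mc′ i = trans (Mc i) (sym (cong₂ _+ℚ_ (ℚ.*-identityˡ (N i c)) (ℚ.*-identityˡ (P i c))))

-- B y z = det (M with columns a, b replaced by y, z) is bilinear and vanishes on the diagonal,
-- so  0 = B (U + W) (U + W) = B U W + B W U  for the columns U, W of M at a, b.
det-swapCols-of-alternating : ∀ n (M : Matrix n) a b → a ≢ b →
  (∀ (N : Matrix n) → (∀ i → N i a ≡ N i b) → det n N ≡ 0ℚ) →
  det n (λ i k → M i (PC.transpose a b k)) ≡ - det n M
det-swapCols-of-alternating n M a b a≢b alternating = begin
  det n Mτ                            ≡⟨ solve 2 (λ d e → e := (d :+ e) :- d) refl (det n M) (det n Mτ) ⟩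
  (det n M +ℚ det n Mτ) -ℚ det n M    ≡⟨ cong (_-ℚ det n M) sum≡0 ⟩
  0ℚ -ℚ det n M                       ≡⟨ ℚ.+-identityˡ (- det n M) ⟩
  - det n M                           ∎
  where
  Mτ : Matrix n
  Mτ i k = M i (PC.transpose a b k)
  U W V : Fin n → ℚ
  U i = M i a
  W i = M i b
  V i = U i +ℚ W i
  B : (Fin n → ℚ) → (Fin n → ℚ) → ℚ
  B y z = det n (replaceCols M a b y z)
  B-diag : ∀ y → B y y ≡ 0ℚ
  B-diag y = alternating _ (λ i → trans (replaceCols-a M a b y y i) (sym (replaceCols-b M a b a≢b y y i)))
  B-+ˡ : ∀ y y′ z → B (λ i → y i +ℚ y′ i) z ≡ B y z +ℚ B y′ z
  B-+ˡ y y′ z = det-additive n _ _ _ a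
    (λ i k k≢a → replaceCols-congˡ M a b _ y z i k≢a) (λ i k k≢a → replaceCols-congˡ M a b _ y′ z i k≢a)
    (λ i → trans (replaceCols-a M a b _ z i)
                 (sym (cong₂ _+ℚ_ (replaceCols-a M a b y z i) (replaceCols-a M a b y′ z i))))
  B-+ʳ : ∀ y z z′ → B y (λ i → z i +ℚ z′ i) ≡ B y z +ℚ B y z′
  B-+ʳ y z z′ = det-additive n _ _ _ b
    (λ i k k≢b → replaceCols-congʳ M a b y _ z i k≢b) (λ i k k≢b → replaceCols-congʳ M a b y _ z′ i k≢b)
    (λ i → trans (replaceCols-b M a b a≢b y _ i)
                 (sym (cong₂ _+ℚ_ (replaceCols-b M a b a≢b y z i) (replaceCols-b M a b a≢b y z′ i))))
  B-UW : B U W ≡ det n M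
  B-UW = det-cong n entry
    where
    entry : ∀ i k → replaceCols M a b U W i k ≡ M i k
    entry i k with k ≟ a | k ≟ b
    ... | yes refl | _        = refl
    ... | no _     | yes refl = refl
    ... | no _     | no _     = refl
  B-WU : B W U ≡ det n Mτ
  B-WU = det-cong n entry
    where
    entry : ∀ i k → replaceCols M a b W U i k ≡ Mτ i k
    entry i k = by-cases (k ≟ a) (k ≟ b)
      where
      by-cases : Dec (k ≡ a) → Dec (k ≡ b) → replaceCols M a b W U i k ≡ Mτ i k
      by-cases (yes refl) _          = trans (replaceCols-a M a b W U i) (cong (M i) (sym (transpose-matchˡ a b)))
      by-cases (no _)     (yes refl) = trans (replaceCols-b M a b a≢b W U i) (cong (M i) (sym (transpose-matchʳ a b)))
      by-cases (no k≢a)   (no k≢b)   = trans (replaceCols-other M a b W U i k≢a k≢b)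
                                             (cong (M i) (sym (transpose-mismatch a b k≢a k≢b)))
  sum≡0 : det n M +ℚ det n Mτ ≡ 0ℚ
  sum≡0 = begin
    det n M +ℚ det n Mτ                   ≡⟨ cong₂ _+ℚ_ B-UW B-WU ⟨
    B U W +ℚ B W U                        ≡⟨ cong₂ _+ℚ_ (trans (cong (_+ℚ B U W) (B-diag U)) (ℚ.+-identityˡ (B U W)))
                                                        (trans (cong (B W U +ℚ_) (B-diag W)) (ℚ.+-identityʳ (B W U))) ⟨
    (B U U +ℚ B U W) +ℚ (B W U +ℚ B W W)  ≡⟨ cong₂ _+ℚ_ (B-+ʳ U U W) (B-+ʳ W U W) ⟨
    B U V +ℚ B W V                        ≡⟨ B-+ˡ U W V ⟨
    B V V                                 ≡⟨ B-diag V ⟩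
    0ℚ                                    ∎

-- Swapping column b with its left neighbour brings the two equal columns one step closer.
det-equalCols-at-distance : ∀ d n (M : Matrix n) a b → toℕ b ≡ suc (d + toℕ a) →
                            (∀ i → M i a ≡ M i b) → det n M ≡ 0ℚ
det-equalCols-at-distance zero    n M a b b=a+1   Ma≡Mb = det-adjacentCols n M a b b=a+1 Ma≡Mb
det-equalCols-at-distance (suc d) n M a b b=a+d+2 Ma≡Mb = begin
  det n M       ≡⟨ solve 1 (λ x → x := :- (:- x)) refl (det n M) ⟩
  - - det n M   ≡⟨ cong -_ swapped ⟨
  - det n Mτ    ≡⟨ cong -_ (det-equalCols-at-distance d n Mτ a c c=a+d+1 Mτa≡Mτc) ⟩
  0ℚ            ∎
  where
  c<n : suc (d + toℕ a) < n
  c<n = ℕ.<-trans (ℕ.n<1+n _) (subst (_< n) b=a+d+2 (Fin.toℕ<n b))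
  c : Fin n
  c = fromℕ< c<n
  c=a+d+1 : toℕ c ≡ suc (d + toℕ a)
  c=a+d+1 = Fin.toℕ-fromℕ< c<n
  b=c+1 : toℕ b ≡ suc (toℕ c)
  b=c+1 = trans b=a+d+2 (cong suc (sym c=a+d+1))
  Mτ : Matrix n
  Mτ i k = M i (PC.transpose c b k)
  swapped : det n Mτ ≡ - det n M
  swapped = det-swapCols-of-alternating n M c b (λ c≡b → ℕ.<⇒≢ (ℕ.n<1+n _) (trans (cong toℕ c≡b) b=c+1))
              (λ N → det-adjacentCols n N c b b=c+1)
  Mτa≡Mτc : ∀ i → Mτ i a ≡ Mτ i c
  Mτa≡Mτc i = begin
    M i (PC.transpose c b a)   ≡⟨ cong (M i) (transpose-mismatch c b a≢c a≢b) ⟩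
    M i a                      ≡⟨ Ma≡Mb i ⟩
    M i b                      ≡⟨ cong (M i) (transpose-matchˡ c b) ⟨
    M i (PC.transpose c b c)   ∎
    where
    a≢c : a ≢ c
    a≢c a≡c = ℕ.m≢1+n+m (toℕ a) (trans (cong toℕ a≡c) c=a+d+1)
    a≢b : a ≢ b
    a≢b a≡b = ℕ.m≢1+n+m (toℕ a) (trans (cong toℕ a≡b) b=a+d+2)

det-equalCols : ∀ n (M : Matrix n) a b → a ≢ b → (∀ i → M i a ≡ M i b) → det n M ≡ 0ℚ
det-equalCols n M a b a≢b Ma≡Mb with ℕ.<-cmp (toℕ a) (toℕ b)
... | tri< a<b _ _ = let (d , a+1+d≡b) = ℕ.m≤n⇒∃[o]m+o≡n a<b in
  det-equalCols-at-distance d n M a b (trans (sym a+1+d≡b) (cong suc (ℕ.+-comm (toℕ a) d))) Ma≡Mb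
... | tri≈ _ a≡b _ = contradiction (Fin.toℕ-injective a≡b) a≢b
... | tri> _ _ b<a = let (d , b+1+d≡a) = ℕ.m≤n⇒∃[o]m+o≡n b<a in
  det-equalCols-at-distance d n M b a (trans (sym b+1+d≡a) (cong suc (ℕ.+-comm (toℕ b) d))) (sym ∘ Ma≡Mb)

det-swapCols : ∀ n (M : Matrix n) a b → a ≢ b → det n (λ i k → M i (PC.transpose a b k)) ≡ - det n M
det-swapCols n M a b a≢b = det-swapCols-of-alternating n M a b a≢b (λ N → det-equalCols n N a b a≢b)

det-swapRows : ∀ n (M : Matrix n) a b → a ≢ b → det n (λ i k → M (PC.transpose a b i) k) ≡ - det n M
det-swapRows n M a b a≢b = begin
  det n (λ i k → M (PC.transpose a b i) k)   ≡⟨ det-ᵀ n _ ⟨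
  det n (λ i k → M (PC.transpose a b k) i)   ≡⟨ det-swapCols n (M ᵀ) a b a≢b ⟩
  - det n (M ᵀ)                              ≡⟨ cong -_ (det-ᵀ n M) ⟩
  - det n M                                  ∎

det-addCol : ∀ n (M N : Matrix n) a b β → a ≢ b → (∀ i k → k ≢ b → N i k ≡ M i k) →
             (∀ i → N i b ≡ M i b +ℚ β * M i a) → det n N ≡ det n M
det-addCol n M N a b β a≢b N≈M Nb = begin
  det n N                        ≡⟨ det-linear n N M P b 1ℚ β N≈M N≈P Nb′ ⟩
  1ℚ * det n M +ℚ β * det n P    ≡⟨ cong (λ d → 1ℚ * det n M +ℚ β * d) P-singular ⟩
  1ℚ * det n M +ℚ β * 0ℚ         ≡⟨ solve 2 (λ d β → con 1ℚ :* d :+ β :* con 0ℚ := d) refl (det n M) β ⟩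
  det n M                        ∎
  where
  P : Matrix n
  P = replaceCols M a b (λ i → M i a) (λ i → M i a)
  P-singular : det n P ≡ 0ℚ
  P-singular = det-equalCols n P a b a≢b
    (λ i → trans (replaceCols-a M a b _ _ i) (sym (replaceCols-b M a b a≢b _ _ i)))
  N≈P : ∀ i k → k ≢ b → N i k ≡ P i k
  N≈P i k k≢b = trans (N≈M i k k≢b) (sym (by-cases (k ≟ a)))
    where
    by-cases : Dec (k ≡ a) → P i k ≡ M i k
    by-cases (yes refl) = replaceCols-a M a b _ _ i
    by-cases (no k≢a)   = replaceCols-other M a b _ _ i k≢a k≢b
  Nb′ : ∀ i → N i b ≡ 1ℚ * M i b +ℚ β * P i b
  Nb′ i = trans (Nb i) (cong₂ _+ℚ_ (sym (ℚ.*-identityˡ (M i b))) (cong (β *_) (sym (replaceCols-b M a b a≢b _ _ i))))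

det-addRow : ∀ n (M N : Matrix n) a b β → a ≢ b → (∀ i k → i ≢ b → N i k ≡ M i k) →
             (∀ k → N b k ≡ M b k +ℚ β * M a k) → det n N ≡ det n M
det-addRow n M N a b β a≢b N≈M Nb = begin
  det n N         ≡⟨ det-ᵀ n N ⟨
  det n (N ᵀ)     ≡⟨ det-addCol n (M ᵀ) (N ᵀ) a b β a≢b (λ i k → N≈M k i) Nb ⟩
  det n (M ᵀ)     ≡⟨ det-ᵀ n M ⟩
  det n M         ∎

det-conj-transpose : ∀ n (M : Matrix n) a b →
                     det n (λ i k → M (PC.transpose a b i) (PC.transpose a b k)) ≡ det n M
det-conj-transpose n M a b with a ≟ b
... | yes refl = det-cong n (λ i k → cong₂ M (transpose-same a i) (transpose-same a k))
... | no a≢b   = begin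
  det n (λ i k → M (τ i) (τ k))   ≡⟨ det-swapRows n (λ i k → M i (τ k)) a b a≢b ⟩
  - det n (λ i k → M i (τ k))     ≡⟨ cong -_ (det-swapCols n M a b a≢b) ⟩
  - - det n M                     ≡⟨ solve 1 (λ x → :- (:- x) := x) refl (det n M) ⟩
  det n M                         ∎
  where
  τ : Fin n → Fin n
  τ = PC.transpose a b

-- Selection sort: compose π with transpositions until it fixes an initial segment of length n.
det-conj-injective-fixing : ∀ n k d → k + d ≡ n → (π : Fin n → Fin n) → Injective _≡_ _≡_ π →
                            (∀ r → toℕ r < k → π r ≡ r) → ∀ (M : Matrix n) →
                            det n (λ i j → M (π i) (π j)) ≡ det n M
det-conj-injective-fixing n k zero    k+0≡n π π-inj fixed M = det-cong n (λ i j → cong₂ M (fixed′ i) (fixed′ j))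
  where
  fixed′ : ∀ r → π r ≡ r
  fixed′ r = fixed r (subst (toℕ r <_) (trans (sym k+0≡n) (ℕ.+-identityʳ k)) (Fin.toℕ<n r))
det-conj-injective-fixing n k (suc d) k+d+1≡n π π-inj fixed M = begin
  det n (λ i j → M (π i) (π j))      ≡⟨ det-cong n (λ i j → sym (cong₂ M (τ-inv (π i)) (τ-inv (π j)))) ⟩
  det n (λ i j → Mτ (π′ i) (π′ j))   ≡⟨ det-conj-injective-fixing n (suc k) d (trans (sym (ℕ.+-suc k d)) k+d+1≡n)
                                                                  π′ π′-inj fixed′ Mτ ⟩
  det n Mτ                           ≡⟨ det-conj-transpose n M a (π a) ⟩
  det n M                            ∎
  where
  k<n : k < n
  k<n = subst (k <_) k+d+1≡n (ℕ.m<m+n k z<s)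
  a : Fin n
  a = fromℕ< k<n
  τ : Fin n → Fin n
  τ = PC.transpose a (π a)
  τ-inv : ∀ i → τ (τ i) ≡ i
  τ-inv = transpose-involutive a (π a)
  Mτ : Matrix n
  Mτ i j = M (τ i) (τ j)
  π′ : Fin n → Fin n
  π′ = τ ∘ π
  π′-inj : Injective _≡_ _≡_ π′
  π′-inj {i} {j} eq = π-inj (trans (sym (τ-inv (π i))) (trans (cong τ eq) (τ-inv (π j))))
  fixed′ : ∀ r → toℕ r < suc k → π′ r ≡ r
  fixed′ r r<k+1 with ℕ.<-cmp (toℕ r) k
  ... | tri< r<k _ _ = trans (cong τ (fixed r r<k)) (transpose-mismatch a (π a) r≢a r≢πa)
    where
    r≢a : r ≢ a
    r≢a r≡a = ℕ.<⇒≢ r<k (trans (cong toℕ r≡a) (Fin.toℕ-fromℕ< k<n))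
    r≢πa : r ≢ π a
    r≢πa r≡πa = r≢a (π-inj (trans (fixed r r<k) r≡πa))
  ... | tri≈ _ r≡k _ = trans (cong (τ ∘ π) r≡a) (trans (transpose-matchʳ a (π a)) (sym r≡a))
    where
    r≡a : r ≡ a
    r≡a = Fin.toℕ-injective (trans r≡k (sym (Fin.toℕ-fromℕ< k<n)))
  ... | tri> _ _ k<r = contradiction (ℕ.≤-pred r<k+1) (ℕ.<⇒≱ k<r)

det-conj-injective : ∀ n (M : Matrix n) (π : Fin n → Fin n) → Injective _≡_ _≡_ π →
                     det n (λ i j → M (π i) (π j)) ≡ det n M
det-conj-injective n M π π-inj = det-conj-injective-fixing n 0 n refl π π-inj (λ _ ()) M

det-expand-unitRow : ∀ n (M : Matrix (suc n)) → (∀ k → M zero (suc k) ≡ 0ℚ) →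
                     det (suc n) M ≡ M zero zero * det n (minor M zero zero)
det-expand-unitRow n M row₀ = begin
  det (suc n) M                       ≡⟨ det-expand n M ⟩
  sumFin (suc n) (laplaceTerm M)      ≡⟨ sumFin-single (suc n) (laplaceTerm M) zero vanish ⟩
  laplaceTerm M zero                  ≡⟨ ℚ.*-identityˡ _ ⟩
  M zero zero * det n (minor M zero zero) ∎
  where
  vanish : ∀ j → j ≢ zero → laplaceTerm M j ≡ 0ℚ
  vanish zero    0≢0 = contradiction refl 0≢0
  vanish (suc k) _   = begin
    sign (suc (toℕ k)) * (M zero (suc k) * det n (minor M zero (suc k)))
      ≡⟨ cong (λ m → sign (suc (toℕ k)) * (m * det n (minor M zero (suc k)))) (row₀ k) ⟩
    sign (suc (toℕ k)) * (0ℚ * det n (minor M zero (suc k)))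
      ≡⟨ solve 2 (λ s d → s :* (con 0ℚ :* d) := con 0ℚ) refl (sign (suc (toℕ k))) (det n (minor M zero (suc k))) ⟩
    0ℚ ∎

idM-refl : ∀ n (i : Fin n) → idM n i i ≡ 1ℚ
idM-refl n i with i ≟ i
... | yes _   = refl
... | no  i≢i = contradiction refl i≢i

idM-≢ : ∀ n {i j : Fin n} → i ≢ j → idM n i j ≡ 0ℚ
idM-≢ n {i} {j} i≢j with i ≟ j
... | yes i≡j = contradiction i≡j i≢j
... | no  _   = refl

idM-conj : ∀ n (π : Fin n → Fin n) → Injective _≡_ _≡_ π → ∀ i j → idM n (π i) (π j) ≡ idM n i j
idM-conj n π π-inj i j with i ≟ j
... | yes refl = idM-refl n (π i)
... | no  i≢j  = idM-≢ n (i≢j ∘ π-inj)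

idM-suc : ∀ n (i j : Fin n) → idM (suc n) (suc i) (suc j) ≡ idM n i j
idM-suc n i j = by-cases (i ≟ j)
  where
  by-cases : Dec (i ≡ j) → idM (suc n) (suc i) (suc j) ≡ idM n i j
  by-cases (yes refl) = trans (idM-refl (suc n) (suc i)) (sym (idM-refl n i))
  by-cases (no i≢j)   = trans (idM-≢ (suc n) (i≢j ∘ suc-injective)) (sym (idM-≢ n i≢j))

sumFin-idM : ∀ n u (g : Fin n → ℚ) → sumFin n (λ v → idM n u v * g v) ≡ g u
sumFin-idM n u g = begin
  sumFin n (λ v → idM n u v * g v)   ≡⟨ sumFin-single n _ u others ⟩
  idM n u u * g u                    ≡⟨ cong (_* g u) (idM-refl n u) ⟩
  1ℚ * g u                           ≡⟨ ℚ.*-identityˡ (g u) ⟩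
  g u                                ∎
  where
  others : ∀ v → v ≢ u → idM n u v * g v ≡ 0ℚ
  others v v≢u = trans (cong (_* g v) (idM-≢ n (v≢u ∘ sym))) (ℚ.*-zeroˡ (g v))

charMatrix : ∀ n → ℚ → Matrix n → Matrix n
charMatrix n x M i j = x * idM n i j -ℚ M i j

charPoly-cong : ∀ n {M N : Matrix n} x → (∀ i j → M i j ≡ N i j) → charPoly n M x ≡ charPoly n N x
charPoly-cong n x M≗N = det-cong n (λ i j → cong (x * idM n i j -ℚ_) (M≗N i j))

charPoly-conj-injective : ∀ n (M : Matrix n) (π : Fin n → Fin n) → Injective _≡_ _≡_ π → ∀ x →
                          charPoly n (λ i j → M (π i) (π j)) x ≡ charPoly n M x
charPoly-conj-injective n M π π-inj x = begin
  det n (λ i j → x * idM n i j -ℚ M (π i) (π j))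
    ≡⟨ det-cong n (λ i j → cong (λ d → x * d -ℚ M (π i) (π j)) (idM-conj n π π-inj i j)) ⟨
  det n (λ i j → charMatrix n x M (π i) (π j))
    ≡⟨ det-conj-injective n (charMatrix n x M) π π-inj ⟩
  det n (charMatrix n x M) ∎

module _ {n m} (part : Fin n → Fin m) where

  isYes-member : ∀ c v → part v ≡ c → ⌊ part v ≟ c ⌋ ≡ true
  isYes-member c v pv≡c with part v ≟ c
  ... | yes _   = refl
  ... | no pv≢c = contradiction pv≡c pv≢c

  isYes-nonMember : ∀ c v → part v ≢ c → ⌊ part v ≟ c ⌋ ≡ false
  isYes-nonMember c v pv≢c with part v ≟ c
  ... | yes pv≡c = contradiction pv≡c pv≢c
  ... | no _     = refl

  inPart-member : ∀ {c v} → part v ≡ c → inPart part c v ≡ 1ℚ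
  inPart-member {c} {v} pv≡c = cong (if_then 1ℚ else 0ℚ) (isYes-member c v pv≡c)

  inPart-nonMember : ∀ {c v} → part v ≢ c → inPart part c v ≡ 0ℚ
  inPart-nonMember {c} {v} pv≢c = cong (if_then 1ℚ else 0ℚ) (isYes-nonMember c v pv≢c)

inPart-subst : ∀ {n m} (part : Fin n → Fin m) c v (f : Fin m → ℚ) →
               inPart part c v * f (part v) ≡ inPart part c v * f c
inPart-subst part c v f with part v ≟ c
... | yes refl = refl
... | no  _    = trans (ℚ.*-zeroˡ (f (part v))) (sym (ℚ.*-zeroˡ (f c)))

inPart-cong : ∀ {n m} (part : Fin n → Fin m) c {u v} → part u ≡ part v → inPart part c u ≡ inPart part c v
inPart-cong part c eq = cong (λ d → if ⌊ d ≟ c ⌋ then 1ℚ else 0ℚ) eq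

inPart≡idM : ∀ {n m} (part : Fin n → Fin m) d u → inPart part d u ≡ idM m (part u) d
inPart≡idM part d u with part u ≟ d
... | yes _ = refl
... | no  _ = refl

partSize-positive : ∀ n {m} (part : Fin n → Fin m) {c} v → part v ≡ c → 0 < partSize n m part c
partSize-positive (suc n) part {c} v pv≡c
  rewrite countFin-punchIn n (λ u → ⌊ part u ≟ c ⌋) v | isYes-member part c v pv≡c = s≤s z≤n

partSize-injective : ∀ n {m} (part : Fin n → Fin m) → Injective _≡_ _≡_ part →
                     ∀ u → partSize n m part (part u) ≡ 1
partSize-injective (suc n) part part-inj u = begin
  countFin (suc n) member
    ≡⟨ countFin-punchIn n member u ⟩
  (if member u then 1 else 0) + countFin n (member ∘ punchIn u)
    ≡⟨ cong₂ (λ b k → (if b then 1 else 0) + k) (isYes-member part (part u) u refl) others ⟩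
  1 ∎
  where
  member : Fin (suc n) → Bool
  member v = ⌊ part v ≟ part u ⌋
  others : countFin n (member ∘ punchIn u) ≡ 0
  others = countFin-none n _ (λ r → isYes-nonMember part (part u) _ (punchInᵢ≢i u r ∘ part-inj))

pivot : ∀ {n} → Fin (suc n) → Fin (suc n) → Fin (suc n)
pivot u zero    = u
pivot u (suc r) = punchIn u r

pivot-injective : ∀ {n} (u : Fin (suc n)) → Injective _≡_ _≡_ (pivot u)
pivot-injective u {zero}  {zero}  _  = refl
pivot-injective u {zero}  {suc s} eq = contradiction (sym eq) (punchInᵢ≢i u s)
pivot-injective u {suc r} {zero}  eq = contradiction eq (punchInᵢ≢i u r)
pivot-injective u {suc r} {suc s} eq = cong suc (punchIn-injective u r s eq)

partSize-pivot : ∀ n {m} (part : Fin (suc n) → Fin m) u c →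
                 partSize (suc n) m (part ∘ pivot u) c ≡ partSize (suc n) m part c
partSize-pivot n part u c = sym (countFin-punchIn n (λ v → ⌊ part v ≟ c ⌋) u)

sameClass-or-injective : ∀ {n m} (part : Fin n → Fin m) →
                         (∃₂ λ u u′ → u ≢ u′ × part u ≡ part u′) ⊎ Injective _≡_ _≡_ part
sameClass-or-injective part with Fin.any? (λ u → Fin.any? (λ u′ → ¬? (u ≟ u′) ×-dec (part u ≟ part u′)))
... | yes (u , u′ , pair) = inj₁ (u , u′ , pair)
... | no  no-pair         = inj₂ injective
  where
  injective : Injective _≡_ _≡_ part
  injective {u} {u′} same with u ≟ u′
  ... | yes u≡u′ = u≡u′
  ... | no  u≢u′ = contradiction (u , u′ , u≢u′ , same) no-pair

-- Blow-ups of a class-interaction matrix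

-- In matrix form  P a Pᵀ diag(w) − diag(a (part v) (part v)),  with P u c = [part u = c].
blowUp : ∀ {n m} → (Fin n → Fin m) → (Fin n → ℚ) → (Fin m → Fin m → ℚ) → Matrix n
blowUp {n} part w a u v = w v * a (part u) (part v) -ℚ idM n u v * a (part v) (part v)

blowUp-conj : ∀ {n m} (part : Fin n → Fin m) w a (π : Fin n → Fin n) → Injective _≡_ _≡_ π →
              ∀ i j → blowUp part w a (π i) (π j) ≡ blowUp (part ∘ π) (w ∘ π) a i j
blowUp-conj {n} part w a π π-inj i j =
  cong (λ d → w (π j) * a (part (π i)) (part (π j)) -ℚ d * a (part (π j)) (part (π j))) (idM-conj n π π-inj i j)

merge : ∀ {n} → Fin n → (Fin (suc n) → ℚ) → Fin n → ℚ
merge {n} k w i = w (suc i) +ℚ idM n i k * w zero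

classWeight : ∀ {n m} → (Fin n → Fin m) → (Fin n → ℚ) → Fin m → ℚ
classWeight {n} part w c = sumFin n (λ v → inPart part c v * w v)

classFactor : ∀ n {m} → (Fin n → Fin m) → (Fin m → Fin m → ℚ) → ℚ → ℚ
classFactor n {m} part a x = prodFin m (λ c → powℚ (x +ℚ a c c) (partSize n m part c ∸ 1))

classWeight-pivot : ∀ n {m} (part : Fin (suc n) → Fin m) w u c →
                    classWeight (part ∘ pivot u) (w ∘ pivot u) c ≡ classWeight part w c
classWeight-pivot n part w u c = sym (sumFin-punchIn n (λ v → inPart part c v * w v) u)

classWeight-merge : ∀ n {m} (part : Fin (suc n) → Fin m) w k → part (suc k) ≡ part zero →
                    ∀ c → classWeight (part ∘ suc) (merge k w) c ≡ classWeight part w c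
classWeight-merge n part w k same c = begin
  sumFin n (λ i → χ (suc i) * (w (suc i) +ℚ idM n i k * w zero))
    ≡⟨ sumFin-cong n (λ i → ℚ.*-distribˡ-+ (χ (suc i)) _ _) ⟩
  sumFin n (λ i → χ (suc i) * w (suc i) +ℚ χ (suc i) * (idM n i k * w zero))
    ≡⟨ sumFin-+ n (λ i → χ (suc i) * w (suc i)) (λ i → χ (suc i) * (idM n i k * w zero)) ⟩
  sumFin n (λ i → χ (suc i) * w (suc i)) +ℚ sumFin n (λ i → χ (suc i) * (idM n i k * w zero))
    ≡⟨ cong (sumFin n (λ i → χ (suc i) * w (suc i)) +ℚ_) moved ⟩
  sumFin n (λ i → χ (suc i) * w (suc i)) +ℚ χ zero * w zero
    ≡⟨ ℚ.+-comm _ (χ zero * w zero) ⟩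
  classWeight part w c ∎
  where
  χ : Fin (suc n) → ℚ
  χ = inPart part c
  moved : sumFin n (λ i → χ (suc i) * (idM n i k * w zero)) ≡ χ zero * w zero
  moved = begin
    sumFin n (λ i → χ (suc i) * (idM n i k * w zero))
      ≡⟨ sumFin-single n _ k others ⟩
    χ (suc k) * (idM n k k * w zero)
      ≡⟨ cong₂ (λ e d → e * (d * w zero)) (inPart-cong part c same) (idM-refl n k) ⟩
    χ zero * (1ℚ * w zero)
      ≡⟨ cong (χ zero *_) (ℚ.*-identityˡ (w zero)) ⟩
    χ zero * w zero ∎
    where
    others : ∀ i → i ≢ k → χ (suc i) * (idM n i k * w zero) ≡ 0ℚ
    others i i≢k = trans (cong (λ d → χ (suc i) * (d * w zero)) (idM-≢ n i≢k))
                         (solve 2 (λ a b → a :* (con 0ℚ :* b) := con 0ℚ) refl (χ (suc i)) (w zero))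

classWeight-injective : ∀ n {m} (part : Fin n → Fin m) w → Injective _≡_ _≡_ part →
                        ∀ u → classWeight part w (part u) ≡ w u
classWeight-injective n part w part-inj u = begin
  sumFin n (λ v → inPart part (part u) v * w v)   ≡⟨ sumFin-single n _ u others ⟩
  inPart part (part u) u * w u                    ≡⟨ cong (_* w u) (inPart-member part refl) ⟩
  1ℚ * w u                                        ≡⟨ ℚ.*-identityˡ (w u) ⟩
  w u                                             ∎
  where
  others : ∀ v → v ≢ u → inPart part (part u) v * w v ≡ 0ℚ
  others v v≢u = trans (cong (_* w v) (inPart-nonMember part (v≢u ∘ part-inj))) (ℚ.*-zeroˡ (w v))

classFactor-merge : ∀ n {m} (part : Fin (suc n) → Fin m) a x k → part (suc k) ≡ part zero →
  classFactor (suc n) part a x ≡ (x +ℚ a (part zero) (part zero)) * classFactor n (part ∘ suc) a x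
classFactor-merge n {m} part a x k same = prodFin-update m _ _ (x +ℚ a c c) c grown unchanged
  where
  c = part zero
  size : Fin m → ℕ
  size = partSize n m (part ∘ suc)
  grown : powℚ (x +ℚ a c c) (partSize (suc n) m part c ∸ 1) ≡ (x +ℚ a c c) * powℚ (x +ℚ a c c) (size c ∸ 1)
  grown rewrite isYes-member part c zero refl = powℚ-pred (x +ℚ a c c) (partSize-positive n (part ∘ suc) k same)
  unchanged : ∀ d → d ≢ c → powℚ (x +ℚ a d d) (partSize (suc n) m part d ∸ 1) ≡ powℚ (x +ℚ a d d) (size d ∸ 1)
  unchanged d d≢c rewrite isYes-nonMember part d zero (d≢c ∘ sym) = refl

-- Subtracting row (suc k) from row 0 and then adding column 0 to column (suc k) turns row 0
-- into (x + a c c, 0, …, 0) and merges the weight of vertex 0 into vertex (suc k).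
charPoly-blowUp-merge : ∀ {m} n (part : Fin (suc n) → Fin m) w a x k → part (suc k) ≡ part zero →
  charPoly (suc n) (blowUp part w a) x
    ≡ (x +ℚ a (part zero) (part zero)) * charPoly n (blowUp (part ∘ suc) (merge k w) a) x
charPoly-blowUp-merge n part w a x k same = begin
  det (suc n) N
    ≡⟨ det-addRow (suc n) N N₁ (suc k) zero (- 1ℚ) (λ ()) N₁-rest (λ _ → refl) ⟨
  det (suc n) N₁
    ≡⟨ det-addCol (suc n) N₁ N₂ zero (suc k) 1ℚ (λ ()) N₂-rest N₂-col ⟨
  det (suc n) N₂
    ≡⟨ det-expand-unitRow n N₂ N₂-row₀ ⟩
  N₂ zero zero * det n (minor N₂ zero zero)
    ≡⟨ cong₂ _*_ N₂-corner (det-cong n N₂-minor) ⟩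
  (x +ℚ s) * charPoly n (blowUp (part ∘ suc) (merge k w) a) x ∎
  where
  s : ℚ
  s = a (part zero) (part zero)
  N N₁ N₂ : Matrix (suc n)
  N = charMatrix (suc n) x (blowUp part w a)
  N₁ zero    v = N zero v +ℚ - 1ℚ * N (suc k) v
  N₁ (suc r) v = N (suc r) v
  N₂ i zero    = N₁ i zero
  N₂ i (suc j) = N₁ i (suc j) +ℚ idM n j k * N₁ i zero

  N₁-rest : ∀ i v → i ≢ zero → N₁ i v ≡ N i v
  N₁-rest zero    v 0≢0 = contradiction refl 0≢0
  N₁-rest (suc r) v _   = refl

  N₂-rest : ∀ i v → v ≢ suc k → N₂ i v ≡ N₁ i v
  N₂-rest i zero    _      = refl
  N₂-rest i (suc j) j+1≢k+1 rewrite idM-≢ n (j+1≢k+1 ∘ cong suc) =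
    solve 2 (λ y z → y :+ con 0ℚ :* z := y) refl (N₁ i (suc j)) (N₁ i zero)

  N₂-col : ∀ i → N₂ i (suc k) ≡ N₁ i (suc k) +ℚ 1ℚ * N₁ i zero
  N₂-col i = cong (λ d → N₁ i (suc k) +ℚ d * N₁ i zero) (idM-refl n k)

  N₂-corner : N₂ zero zero ≡ x +ℚ s
  N₂-corner rewrite same = solve 3 (λ x w₀ s →
      (x :* con 1ℚ :- (w₀ :* s :- con 1ℚ :* s)) :+ con (- 1ℚ) :* (x :* con 0ℚ :- (w₀ :* s :- con 0ℚ :* s))
      := x :+ s) refl x (w zero) s

  N₂-row₀ : ∀ j → N₂ zero (suc j) ≡ 0ℚ
  N₂-row₀ j = by-cases (j ≟ k)
    where
    by-cases : Dec (j ≡ k) → N₂ zero (suc j) ≡ 0ℚ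
    by-cases (yes refl) rewrite idM-refl (suc n) (suc k) | idM-refl n k | same = solve 4 (λ x W w₀ s →
      (x :* con 0ℚ :- (W :* s :- con 0ℚ :* s) :+ con (- 1ℚ) :* (x :* con 1ℚ :- (W :* s :- con 1ℚ :* s)))
      :+ con 1ℚ :* ((x :* con 1ℚ :- (w₀ :* s :- con 1ℚ :* s)) :+ con (- 1ℚ) :* (x :* con 0ℚ :- (w₀ :* s :- con 0ℚ :* s)))
      := con 0ℚ) refl x (w (suc k)) (w zero) s
    by-cases (no j≢k) = trans (N₂-rest zero (suc j) (j≢k ∘ suc-injective)) N₁₀
      where
      N₁₀ : N₁ zero (suc j) ≡ 0ℚ
      N₁₀ rewrite idM-suc n k j | idM-≢ n (j≢k ∘ sym) | same = solve 4 (λ x W A B →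
        x :* con 0ℚ :- (W :* A :- con 0ℚ :* B) :+ con (- 1ℚ) :* (x :* con 0ℚ :- (W :* A :- con 0ℚ :* B))
        := con 0ℚ) refl x (w (suc j)) (a (part zero) (part (suc j))) (a (part (suc j)) (part (suc j)))

  N₂-minor : ∀ r j → N₂ (suc r) (suc j) ≡ charMatrix n x (blowUp (part ∘ suc) (merge k w) a) r j
  N₂-minor r j = by-cases (j ≟ k)
    where
    by-cases : Dec (j ≡ k) → N₂ (suc r) (suc j) ≡ charMatrix n x (blowUp (part ∘ suc) (merge k w) a) r j
    by-cases (yes refl) rewrite idM-suc n r j | idM-refl n j | same = solve 6 (λ x δ W w₀ A B →
      (x :* δ :- (W :* A :- δ :* B)) :+ con 1ℚ :* (x :* con 0ℚ :- (w₀ :* A :- con 0ℚ :* B))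
      := x :* δ :- ((W :+ con 1ℚ :* w₀) :* A :- δ :* B))
      refl x (idM n r j) (w (suc j)) (w zero) (a (part (suc r)) (part zero)) (a (part zero) (part zero))
    by-cases (no j≢k) rewrite idM-suc n r j | idM-≢ n j≢k = solve 8 (λ x δ W w₀ A B A₀ B₀ →
      (x :* δ :- (W :* A :- δ :* B)) :+ con 0ℚ :* (x :* con 0ℚ :- (w₀ :* A₀ :- con 0ℚ :* B₀))
      := x :* δ :- ((W :+ con 0ℚ :* w₀) :* A :- δ :* B))
      refl x (idM n r j) (w (suc j)) (w zero) (a (part (suc r)) (part (suc j))) (a (part (suc j)) (part (suc j)))
      (a (part (suc r)) (part zero)) (a (part zero) (part zero))

charPoly-blowUp-bijective : ∀ n {m} (part : Fin n → Fin m) w a x →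
  Injective _≡_ _≡_ part → (∀ c → ∃ λ u → part u ≡ c) →
  charPoly n (blowUp part w a) x ≡ classFactor n part a x * charPoly m (blowUp id (classWeight part w) a) x
charPoly-blowUp-bijective n {m} part w a x part-inj surj
  with ℕ.≤-antisym (Fin.injective⇒≤ part-inj) (Fin.injective⇒≤ section-inj)
  where
  section-inj : Injective _≡_ _≡_ (λ c → proj₁ (surj c))
  section-inj {c} {d} eq = trans (sym (proj₂ (surj c))) (trans (cong part eq) (proj₂ (surj d)))
... | refl = begin
  charPoly n (blowUp part w a) x                        ≡⟨ charPoly-cong n x entries ⟩
  charPoly n (λ i j → B (part i) (part j)) x            ≡⟨ charPoly-conj-injective n B part part-inj x ⟩
  charPoly n B x                                        ≡⟨ ℚ.*-identityˡ (charPoly n B x) ⟨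
  1ℚ * charPoly n B x                                   ≡⟨ cong (_* charPoly n B x) (prodFin-ones n _ singleton) ⟨
  classFactor n part a x * charPoly n B x               ∎
  where
  B : Matrix n
  B = blowUp id (classWeight part w) a
  entries : ∀ i j → blowUp part w a i j ≡ B (part i) (part j)
  entries i j = cong₂ (λ v d → v * a (part i) (part j) -ℚ d * a (part j) (part j))
                      (sym (classWeight-injective n part w part-inj j)) (sym (idM-conj n part part-inj i j))
  singleton : ∀ c → powℚ (x +ℚ a c c) (partSize n n part c ∸ 1) ≡ 1ℚ
  singleton c with surj c
  ... | u , refl = cong (λ k → powℚ (x +ℚ a (part u) (part u)) (k ∸ 1)) (partSize-injective n part part-inj u)

-- Induction on n: while some class has two vertices, move one of them to the front (`pivot`) and merge.
charPoly-blowUp : ∀ n {m} (part : Fin n → Fin m) w a x → (∀ c → ∃ λ u → part u ≡ c) →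
  charPoly n (blowUp part w a) x ≡ classFactor n part a x * charPoly m (blowUp id (classWeight part w) a) x
charPoly-blowUp zero    part w a x surj = charPoly-blowUp-bijective zero part w a x (λ {i} → ⊥-elim (Fin.¬Fin0 i)) surj
charPoly-blowUp (suc n) {m} part w a x surj with sameClass-or-injective part
... | inj₂ part-inj                 = charPoly-blowUp-bijective (suc n) part w a x part-inj surj
... | inj₁ (u , u′ , u≢u′ , same) = begin
  charPoly (suc n) (blowUp part w a) x
    ≡⟨ charPoly-conj-injective (suc n) (blowUp part w a) π (pivot-injective u′) x ⟨
  charPoly (suc n) (λ i j → blowUp part w a (π i) (π j)) x
    ≡⟨ charPoly-cong (suc n) x (blowUp-conj part w a π (pivot-injective u′)) ⟩
  charPoly (suc n) (blowUp part₁ w₁ a) x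
    ≡⟨ charPoly-blowUp-merge n part₁ w₁ a x k same₁ ⟩
  (x +ℚ s) * charPoly n (blowUp (part₁ ∘ suc) (merge k w₁) a) x
    ≡⟨ cong ((x +ℚ s) *_) (charPoly-blowUp n (part₁ ∘ suc) (merge k w₁) a x surj₁) ⟩
  (x +ℚ s) * (classFactor n (part₁ ∘ suc) a x * charPoly m (blowUp id W₁ a) x)
    ≡⟨ cong (λ d → (x +ℚ s) * (classFactor n (part₁ ∘ suc) a x * d)) (charPoly-cong m x sameWeights) ⟩
  (x +ℚ s) * (classFactor n (part₁ ∘ suc) a x * charPoly m (blowUp id W a) x)
    ≡⟨ ℚ.*-assoc (x +ℚ s) _ _ ⟨
  ((x +ℚ s) * classFactor n (part₁ ∘ suc) a x) * charPoly m (blowUp id W a) x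
    ≡⟨ cong (_* charPoly m (blowUp id W a) x) factor ⟨
  classFactor (suc n) part a x * charPoly m (blowUp id W a) x ∎
  where
  π : Fin (suc n) → Fin (suc n)
  π = pivot u′
  part₁ : Fin (suc n) → Fin m
  part₁ = part ∘ π
  w₁ : Fin (suc n) → ℚ
  w₁ = w ∘ π
  s : ℚ
  s = a (part u′) (part u′)
  u′≢u : u′ ≢ u
  u′≢u = u≢u′ ∘ sym
  k : Fin n
  k = punchOut u′≢u
  W W₁ : Fin m → ℚ
  W = classWeight part w
  W₁ = classWeight (part₁ ∘ suc) (merge k w₁)
  same₁ : part₁ (suc k) ≡ part₁ zero
  same₁ = trans (cong part (punchIn-punchOut u′≢u)) same
  surj₁ : ∀ c → ∃ λ r → part₁ (suc r) ≡ c
  surj₁ c with surj c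
  ... | v , pv≡c with v ≟ u′
  ...   | yes refl = k , trans same₁ pv≡c
  ...   | no  v≢u′ = punchOut (v≢u′ ∘ sym) , trans (cong part (punchIn-punchOut (v≢u′ ∘ sym))) pv≡c
  sameWeights : ∀ i j → blowUp id W₁ a i j ≡ blowUp id W a i j
  sameWeights i j = cong (λ v → v * a i j -ℚ idM m i j * a j j)
    (trans (classWeight-merge n part₁ w₁ k same₁ j) (classWeight-pivot n part w u′ j))
  factor : classFactor (suc n) part a x ≡ (x +ℚ s) * classFactor n (part₁ ∘ suc) a x
  factor = trans (prodFin-cong m (λ c → cong (λ t → powℚ (x +ℚ a c c) (t ∸ 1))
                                             (sym (partSize-pivot n part u′ c))))
                 (classFactor-merge n part₁ a x k same₁)

-- The quotient matrix

fromℕ : ℕ → ℚ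
fromℕ zero    = 0ℚ
fromℕ (suc k) = 1ℚ +ℚ fromℕ k

-- `fromℕ` is what summing indicators produces; `integral` is its normal form, whose inverse is
-- the `(+ 1) / suc k` used by `average`.
integral : ℕ → ℚ
integral k = mkℚ (ℤ.+ k) 0 (Coprimality.sym (Coprimality.1-coprimeTo k))

fromℕ≡integral : ∀ k → fromℕ k ≡ integral k
fromℕ≡integral zero    = refl
fromℕ≡integral (suc k) = trans (cong (1ℚ +ℚ_) (fromℕ≡integral k))
  (ℚ.toℚᵘ-injective (ℚᵘ.≃-trans (ℚ.toℚᵘ-homo-+ 1ℚ (integral k))
                                (ℚᵘ.*≡* (cong (λ t → (ℤ.+ 1 ℤ.+ t) ℤ.* ℤ.+ 1) (ℤ.*-identityʳ (ℤ.+ k))))))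

fromℕ-suc-*-inverse : ∀ k → fromℕ (suc k) * ((ℤ.+ 1) / suc k) ≡ 1ℚ
fromℕ-suc-*-inverse k = begin
  fromℕ (suc k) * ((ℤ.+ 1) / suc k)
    ≡⟨ cong₂ _*_ (fromℕ≡integral (suc k)) (ℚ.normalize-coprime (Coprimality.1-coprimeTo (suc k))) ⟩
  integral (suc k) * 1/ integral (suc k)
    ≡⟨ ℚ.*-inverseʳ (integral (suc k)) ⟩
  1ℚ ∎

average-cancel : ∀ s {k} → 0 < k → average (s * fromℕ k) k ≡ s
average-cancel s {suc k} _ = begin
  (s * fromℕ (suc k)) * ((ℤ.+ 1) / suc k)   ≡⟨ ℚ.*-assoc s _ _ ⟩
  s * (fromℕ (suc k) * ((ℤ.+ 1) / suc k))   ≡⟨ cong (s *_) (fromℕ-suc-*-inverse k) ⟩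
  s * 1ℚ                                    ≡⟨ ℚ.*-identityʳ s ⟩
  s                                         ∎

sumFin-indicator : ∀ n (b : Fin n → Bool) → sumFin n (λ v → (if b v then 1ℚ else 0ℚ) * 1ℚ) ≡ fromℕ (countFin n b)
sumFin-indicator zero    b = refl
sumFin-indicator (suc n) b with b zero
... | true  = cong (1ℚ +ℚ_) (sumFin-indicator n (b ∘ suc))
... | false = trans (ℚ.+-identityˡ _) (sumFin-indicator n (b ∘ suc))

quotientMatrix-cong : ∀ n m {A A′ : Matrix n} part → (∀ u v → A u v ≡ A′ u v) →
                      ∀ c d → quotientMatrix n m A part c d ≡ quotientMatrix n m A′ part c d
quotientMatrix-cong n m part A≗A′ c d = cong (λ t → average t (partSize n m part c))
  (sumFin-cong n (λ u → cong (inPart part c u *_) (sumFin-cong n (λ v → cong (inPart part d v *_) (A≗A′ u v)))))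

-- Every row of the block A_{X_c,X_d} of a blow-up has the same sum.
quotientMatrix-blowUp : ∀ n {m} (part : Fin n → Fin m) a → (∀ c → ∃ λ u → part u ≡ c) → ∀ c d →
  quotientMatrix n m (blowUp part (λ _ → 1ℚ) a) part c d ≡ blowUp id (classWeight part (λ _ → 1ℚ)) a c d
quotientMatrix-blowUp n {m} part a surj c d = begin
  average (sumFin n (λ u → χ c u * rowSum u)) (partSize n m part c)
    ≡⟨ cong (λ t → average t (partSize n m part c)) blockSum ⟩
  average (β c * fromℕ (partSize n m part c)) (partSize n m part c)
    ≡⟨ average-cancel (β c) (partSize-positive n part (proj₁ (surj c)) (proj₂ (surj c))) ⟩
  β c ∎
  where
  χ : Fin m → Fin n → ℚ
  χ = inPart part
  W : Fin m → ℚ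
  W = classWeight part (λ _ → 1ℚ)
  β : Fin m → ℚ
  β e = blowUp id W a e d
  rowSum : Fin n → ℚ
  rowSum u = sumFin n (λ v → χ d v * blowUp part (λ _ → 1ℚ) a u v)
  rowSum≡ : ∀ u → rowSum u ≡ β (part u)
  rowSum≡ u = begin
    rowSum u
      ≡⟨ sumFin-cong n entry ⟩
    sumFin n (λ v → a (part u) d * (χ d v * 1ℚ) +ℚ - 1ℚ * (idM n u v * (χ d v * a d d)))
      ≡⟨ sumFin-+ n (λ v → a (part u) d * (χ d v * 1ℚ)) (λ v → - 1ℚ * (idM n u v * (χ d v * a d d))) ⟩
    sumFin n (λ v → a (part u) d * (χ d v * 1ℚ)) +ℚ sumFin n (λ v → - 1ℚ * (idM n u v * (χ d v * a d d)))
      ≡⟨ cong₂ _+ℚ_ (sumFin-*ˡ n (a (part u) d) _) (sumFin-*ˡ n (- 1ℚ) _) ⟩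
    a (part u) d * W d +ℚ - 1ℚ * sumFin n (λ v → idM n u v * (χ d v * a d d))
      ≡⟨ cong (λ t → a (part u) d * W d +ℚ - 1ℚ * t) (sumFin-idM n u (λ v → χ d v * a d d)) ⟩
    a (part u) d * W d +ℚ - 1ℚ * (χ d u * a d d)
      ≡⟨ cong (λ t → a (part u) d * W d +ℚ - 1ℚ * (t * a d d)) (inPart≡idM part d u) ⟩
    a (part u) d * W d +ℚ - 1ℚ * (idM m (part u) d * a d d)
      ≡⟨ solve 4 (λ A W δ B → A :* W :+ con (- 1ℚ) :* (δ :* B) := W :* A :- δ :* B)
               refl (a (part u) d) (W d) (idM m (part u) d) (a d d) ⟩
    β (part u) ∎
    where
    entry : ∀ v → χ d v * blowUp part (λ _ → 1ℚ) a u v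
                  ≡ a (part u) d * (χ d v * 1ℚ) +ℚ - 1ℚ * (idM n u v * (χ d v * a d d))
    entry v = trans (inPart-subst part d v (λ e → 1ℚ * a (part u) e -ℚ idM n u v * a e e))
      (solve 4 (λ χ A δ B → χ :* (con 1ℚ :* A :- δ :* B) := A :* (χ :* con 1ℚ) :+ con (- 1ℚ) :* (δ :* (χ :* B)))
             refl (χ d v) (a (part u) d) (idM n u v) (a d d))
  blockSum : sumFin n (λ u → χ c u * rowSum u) ≡ β c * fromℕ (partSize n m part c)
  blockSum = begin
    sumFin n (λ u → χ c u * rowSum u)
      ≡⟨ sumFin-cong n (λ u → trans (cong (χ c u *_) (rowSum≡ u)) (inPart-subst part c u β)) ⟩
    sumFin n (λ u → χ c u * β c)
      ≡⟨ sumFin-cong n (λ u → solve 2 (λ χ b → χ :* b := b :* (χ :* con 1ℚ)) refl (χ c u) (β c)) ⟩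
    sumFin n (λ u → β c * (χ c u * 1ℚ))
      ≡⟨ sumFin-*ˡ n (β c) _ ⟩
    β c * W c
      ≡⟨ cong (β c *_) (sumFin-indicator n (λ u → ⌊ part u ≟ c ⌋)) ⟩
    β c * fromℕ (partSize n m part c) ∎

-- Signed complete graphs

module SignedPartition {n p q : ℕ} (σ : Fin n → Fin n → Sign) (part : Fin n → Fin (p + q))
                       (surj : ∀ c → ∃ λ u → part u ≡ c) where

  representative : Fin (p + q) → Fin n
  representative c = proj₁ (surj c)

  classSign : Fin (p + q) → ℚ
  classSign c = [ (λ _ → 1ℚ) , (λ _ → - 1ℚ) ]′ (splitAt p c)

  -- The diagonal entries only matter for classes with at least two vertices.
  interaction : Fin (p + q) → Fin (p + q) → ℚ
  interaction c d with c ≟ d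
  ... | yes _ = classSign c
  ... | no  _ = signVal (σ (representative c) (representative d))

  interaction-diag : ∀ c → interaction c c ≡ classSign c
  interaction-diag c with c ≟ c
  ... | yes _   = refl
  ... | no  c≢c = contradiction refl c≢c

  module _ (between : ∀ u v u′ v′ → part u ≢ part v → part u ≡ part u′ → part v ≡ part v′ → σ u v ≡ σ u′ v′)
           (positive : ∀ (i : Fin p) u v → u ≢ v → part u ≡ i ↑ˡ q → part v ≡ i ↑ˡ q → σ u v ≡ pos)
           (negative : ∀ (i : Fin q) u v → u ≢ v → part u ≡ p ↑ʳ i → part v ≡ p ↑ʳ i → σ u v ≡ neg) where

    interaction-edge : ∀ u v → u ≢ v → interaction (part u) (part v) ≡ signVal (σ u v)
    interaction-edge u v u≢v with part u ≟ part v
    ... | no pu≢pv = cong signVal (sym (between u v _ _ pu≢pv (sym (proj₂ (surj (part u))))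
                                                              (sym (proj₂ (surj (part v))))))
    ... | yes pu≡pv with splitAt p (part u) in eq
    ...   | inj₁ i = cong signVal (sym (positive i u v u≢v pu (trans (sym pu≡pv) pu)))
      where
      pu : part u ≡ i ↑ˡ q
      pu = sym (Fin.splitAt⁻¹-↑ˡ eq)
    ...   | inj₂ i = cong signVal (sym (negative i u v u≢v pu (trans (sym pu≡pv) pu)))
      where
      pu : part u ≡ p ↑ʳ i
      pu = sym (Fin.splitAt⁻¹-↑ʳ eq)

    adjK≡blowUp : ∀ u v → adjK n σ u v ≡ blowUp part (λ _ → 1ℚ) interaction u v
    adjK≡blowUp u v with u ≟ v
    ... | yes refl = solve 1 (λ s → con 0ℚ := con 1ℚ :* s :- con 1ℚ :* s) refl (interaction (part u) (part u))
    ... | no  u≢v  = trans (sym (interaction-edge u v u≢v))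
                           (solve 2 (λ s t → s := con 1ℚ :* s :- con 0ℚ :* t)
                                  refl (interaction (part u) (part v)) (interaction (part v) (part v)))

  interaction-positive : ∀ i → interaction (i ↑ˡ q) (i ↑ˡ q) ≡ 1ℚ
  interaction-positive i = trans (interaction-diag (i ↑ˡ q)) (cong [ _ , _ ]′ (Fin.splitAt-↑ˡ p i q))

  interaction-negative : ∀ i → interaction (p ↑ʳ i) (p ↑ʳ i) ≡ - 1ℚ
  interaction-negative i = trans (interaction-diag (p ↑ʳ i)) (cong [ _ , _ ]′ (Fin.splitAt-↑ʳ p q i))

  classFactor≡powers : ∀ x → classFactor n part interaction x
    ≡ powℚ (x +ℚ 1ℚ) (sumFinℕ p (λ i → partSize n (p + q) part (i ↑ˡ q)) ∸ p)
      * powℚ (x -ℚ 1ℚ) (sumFinℕ q (λ i → partSize n (p + q) part (p ↑ʳ i)) ∸ q)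
  classFactor≡powers x = trans (prodFin-++ p q _) (cong₂ _*_ positives negatives)
    where
    size : Fin (p + q) → ℕ
    size = partSize n (p + q) part
    nonempty : ∀ c → 0 < size c
    nonempty c = partSize-positive n part (proj₁ (surj c)) (proj₂ (surj c))
    positives : prodFin p (λ i → powℚ (x +ℚ interaction (i ↑ˡ q) (i ↑ˡ q)) (size (i ↑ˡ q) ∸ 1))
                ≡ powℚ (x +ℚ 1ℚ) (sumFinℕ p (size ∘ (_↑ˡ q)) ∸ p)
    positives = trans (prodFin-cong p (λ i → cong (λ s → powℚ (x +ℚ s) (size (i ↑ˡ q) ∸ 1)) (interaction-positive i)))
                      (prodFin-powℚ p (x +ℚ 1ℚ) (size ∘ (_↑ˡ q)) (nonempty ∘ (_↑ˡ q)))
    negatives : prodFin q (λ i → powℚ (x +ℚ interaction (p ↑ʳ i) (p ↑ʳ i)) (size (p ↑ʳ i) ∸ 1))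
                ≡ powℚ (x -ℚ 1ℚ) (sumFinℕ q (size ∘ (p ↑ʳ_)) ∸ q)
    negatives = trans (prodFin-cong q (λ i → cong (λ s → powℚ (x +ℚ s) (size (p ↑ʳ i) ∸ 1)) (interaction-negative i)))
                      (prodFin-powℚ q (x -ℚ 1ℚ) (size ∘ (p ↑ʳ_)) (nonempty ∘ (p ↑ʳ_)))

theorem5 : (n p q : ℕ) (σ : Fin n → Fin n → Sign) (part : Fin n → Fin (p + q)) →
  (∀ u v → σ u v ≡ σ v u) →
  (∀ c → ∃ λ u → part u ≡ c) →
  (∀ u v u' v' → part u ≢ part v → part u ≡ part u' → part v ≡ part v' → σ u v ≡ σ u' v') →
  (∀ (i : Fin p) u v → u ≢ v → part u ≡ i ↑ˡ q → part v ≡ i ↑ˡ q → σ u v ≡ pos) →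
  (∀ (i : Fin q) u v → u ≢ v → part u ≡ p ↑ʳ i → part v ≡ p ↑ʳ i → σ u v ≡ neg) →
  (x : ℚ) →
  charPoly n (adjK n σ) x
    ≡ powℚ (x +ℚ 1ℚ) (sumFinℕ p (λ i → partSize n (p + q) part (i ↑ˡ q)) ∸ p)
      * (powℚ (x -ℚ 1ℚ) (sumFinℕ q (λ i → partSize n (p + q) part (p ↑ʳ i)) ∸ q)
      * charPoly (p + q) (quotientMatrix n (p + q) (adjK n σ) part) x)
theorem5 n p q σ part _ surj between positive negative x = begin
  charPoly n (adjK n σ) x
    ≡⟨ charPoly-cong n x adjK≗blowUp ⟩
  charPoly n (blowUp part (λ _ → 1ℚ) interaction) x
    ≡⟨ charPoly-blowUp n part (λ _ → 1ℚ) interaction x surj ⟩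
  classFactor n part interaction x * charPoly (p + q) (blowUp id (classWeight part (λ _ → 1ℚ)) interaction) x
    ≡⟨ cong₂ _*_ (classFactor≡powers x) (charPoly-cong (p + q) x quotient) ⟩
  (powℚ (x +ℚ 1ℚ) e₊ * powℚ (x -ℚ 1ℚ) e₋) * charPoly (p + q) B x
    ≡⟨ ℚ.*-assoc (powℚ (x +ℚ 1ℚ) e₊) _ _ ⟩
  powℚ (x +ℚ 1ℚ) e₊ * (powℚ (x -ℚ 1ℚ) e₋ * charPoly (p + q) B x) ∎
  where
  e₊ e₋ : ℕ
  e₊ = sumFinℕ p (λ i → partSize n (p + q) part (i ↑ˡ q)) ∸ p
  e₋ = sumFinℕ q (λ i → partSize n (p + q) part (p ↑ʳ i)) ∸ q
  B : Matrix (p + q)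
  B = quotientMatrix n (p + q) (adjK n σ) part
  open SignedPartition {n} {p} {q} σ part surj
  adjK≗blowUp : ∀ u v → adjK n σ u v ≡ blowUp part (λ _ → 1ℚ) interaction u v
  adjK≗blowUp = adjK≡blowUp between positive negative
  quotient : ∀ c d → blowUp id (classWeight part (λ _ → 1ℚ)) interaction c d ≡ B c d
  quotient c d = sym (trans (quotientMatrix-cong n (p + q) part adjK≗blowUp c d)
                            (quotientMatrix-blowUp n part interaction surj c d))
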